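{- Let $n$ be a nonnegative integer and let $x,y$ be complex numbers for which all the expressions below are defined. Then \begin{align*} &\sum_{k=0}^{n}(-1)^k\binom{n}{k} \frac{\binom{\frac{x}{2}+k}{k}\binom{x-\frac{1}{2}+k}{k}\binom{y+k}{k}} {\binom{\frac{x-1}{2}+k}{k}\binom{x-\frac{1}{2}+n+k}{k}\binom{x-y-\frac{1}{2}+k}{k}} \frac{1+2x+4k}{1+2x+2n+2k}H_{2k}(x)\\ &=\frac{1}{2}\frac{\binom{x-\frac{1}{2}+n}{n}\binom{\frac{x-3}{2}-y+n}{n}} {\binom{\frac{x-1}{2}+n}{n}\binom{x-y-\frac{1}{2}+n}{n}} \big\{H_n(\tfrac{x-1}{2})-H_n(\tfrac{x-3}{2}-y)\big\}. \end{align*}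
   Context: For a complex number $z$ and a nonnegative integer $t$, $\binom{z}{t}=\frac{z(z-1)\cdots(z-t+1)}{t!}$ (with $\binom{z}{0}=1$). For complex $x$, $H_0(x)=0$ and $H_m(x)=\sum_{j=1}^m\frac{1}{x+j}$ for $m\ge1$. -}

module Defs where

open import Level using (Level; suc; _⊔_)
open import Data.Nat as ℕ using (ℕ; zero) renaming (suc to 1+)
open import Relation.Nullary using (¬_)
open import Algebra.Bundles using (CommutativeRing)

-- A field of characteristic zero, with a total inverse (inv 0 = 0, as in
-- Lean/Mathlib); expressions are "defined" when the inverted quantities are
-- nonzero, which the theorem assumes explicitly.
-- n ↦ 1 + 1 + ... + 1 (n times) in a commutative ring
embed : ∀ {c ℓ} (R : CommutativeRing c ℓ) → ℕ → CommutativeRing.Carrier R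
embed R zero   = CommutativeRing.0# R
embed R (1+ n) = CommutativeRing._+_ R (CommutativeRing.1# R) (embed R n)

record CharZeroField (c ℓ : Level) : Set (suc (c ⊔ ℓ)) where
  field
    commRing : CommutativeRing c ℓ
  open CommutativeRing commRing public
  field
    inv          : Carrier → Carrier
    inv-cong     : ∀ {a b} → a ≈ b → inv a ≈ inv b
    inv-zero     : inv 0# ≈ 0#
    inv-nonzero  : ∀ a → ¬ (a ≈ 0#) → a * inv a ≈ 1#
    0≉1          : ¬ (0# ≈ 1#)
    char-zero    : ∀ n → ¬ (embed commRing (1+ n) ≈ 0#)

module Ops {c ℓ} (F : CharZeroField c ℓ) where
  open CharZeroField F public

  nat : ℕ → Carrier
  nat n = embed commRing n

  _÷_ : Carrier → Carrier → Carrier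
  a ÷ b = a * inv b

  sumTo : ℕ → (ℕ → Carrier) → Carrier
  sumTo zero     f = f 0
  sumTo (1+ n) f = sumTo n f + f (1+ n)

  sum1 : ℕ → (ℕ → Carrier) → Carrier
  sum1 zero     f = 0#
  sum1 (1+ m) f = sum1 m f + f (1+ m)

  prod : ℕ → (ℕ → Carrier) → Carrier
  prod zero     f = 1#
  prod (1+ t) f = prod t f * f t

  sign : ℕ → Carrier
  sign zero     = 1#
  sign (1+ k) = - sign k

  binom : Carrier → ℕ → Carrier
  binom z t = prod t (λ i → z - nat i) ÷ nat (t ℕ.!)

  H : ℕ → Carrier → Carrier
  H m x = sum1 m (λ j → inv (x + nat j))

  half : Carrier
  half = inv (nat 2)

module Submission where

-- Put β = y + 1, γ = x/2 + 1 and A = x + 1/2.  Then H_{2k}(x) = δt A k / 2, where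
-- δt A k = Σ_{i<k} (1/(γ+i) + 1/(A+1-γ+i)) is the logarithmic derivative in γ of
-- the term t n A k of the terminating very-well-poised ₅F₄ summation
--   Σ_k t n A k = R n A = (A)_n (A+1-β-γ)_n / ((A+1-β)_n (A+1-γ)_n),
-- and the left-hand side becomes Σ_k t n A k δt A k / 2, i.e. half the derivative
-- in γ of this sum; the right-hand side is R n A δR n A / 2 with δR the
-- logarithmic derivative of R.  The summation and its derivative are proved by
-- induction on n from the contiguity relation
--   t (n+1) A k = ρ A · t n (A+1) k + g (k+1) - g k
-- with an explicit certificate g, and from the derivative of this relation in γ;
-- as a field has no derivatives, the latter is verified directly as a rational
-- identity, by bringing all terms to a common denominator.

open import Defs
open import Data.Nat using (ℕ; _≤_)
import Data.Nat
open import Relation.Nullary using (¬_)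
open import Data.Nat as ℕ using (zero; _<_; z≤n; s≤s; NonZero) renaming (suc to 1+)
import Data.Nat.Properties as ℕ
open import Data.Product using (_×_; _,_)
open import Data.Maybe using (Maybe; just; nothing)
open import Relation.Nullary using (yes; no)
open import Relation.Binary.PropositionalEquality as ≡ using (_≡_)
open import Algebra.Bundles using (RawRing; CommutativeRing)
import Algebra.Solver.Ring.AlmostCommutativeRing as ACR
import Algebra.Solver.Ring
import Algebra.Properties.Ring
import Algebra.Properties.AbelianGroup
import Algebra.Properties.CommutativeSemigroup

-- A ring solver for commutative rings with integer coefficients; the
-- integer m - n is represented by the pair (m , n), kept reduced so that
-- equal coefficients are syntactically equal.
module IntegerRingSolver {c ℓ} (R : CommutativeRing c ℓ) where
  open CommutativeRing R
  open Algebra.Properties.Ring ring using (x[y-z]≈xy-xz; [y-z]x≈yx-zx)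
  open Algebra.Properties.AbelianGroup +-abelianGroup using (⁻¹-∙-comm; ⁻¹-anti-homo‿-)
  open Algebra.Properties.CommutativeSemigroup +-commutativeSemigroup using (interchange)
  open import Relation.Binary.Reasoning.Setoid setoid

  ι : ℕ → Carrier
  ι = embed R

  ι-homo-+ : ∀ m n → ι (m ℕ.+ n) ≈ ι m + ι n
  ι-homo-+ zero   n = sym (+-identityˡ _)
  ι-homo-+ (1+ m) n = trans (+-congˡ (ι-homo-+ m n)) (sym (+-assoc _ _ _))

  ι-homo-* : ∀ m n → ι (m ℕ.* n) ≈ ι m * ι n
  ι-homo-* zero   n = sym (zeroˡ _)
  ι-homo-* (1+ m) n = begin
    ι (n ℕ.+ m ℕ.* n)         ≈⟨ ι-homo-+ n (m ℕ.* n) ⟩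
    ι n + ι (m ℕ.* n)         ≈⟨ +-cong (sym (*-identityˡ _)) (ι-homo-* m n) ⟩
    1# * ι n + ι m * ι n      ≈⟨ distribʳ _ _ _ ⟨
    (1# + ι m) * ι n          ∎

  private
    reduce : ℕ × ℕ → ℕ × ℕ
    reduce (a , b) = (a ℕ.∸ b , b ℕ.∸ a)

    ℤ-pairs : RawRing _ _
    ℤ-pairs = record
      { Carrier = ℕ × ℕ
      ; _≈_ = _≡_
      ; _+_ = λ { (a , b) (c , d) → reduce (a ℕ.+ c , b ℕ.+ d) }
      ; _*_ = λ { (a , b) (c , d) → reduce (a ℕ.* c ℕ.+ b ℕ.* d , a ℕ.* d ℕ.+ b ℕ.* c) }
      ; -_ = λ { (a , b) → (b , a) }
      ; 0# = (0 , 0)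
      ; 1# = (1 , 0)
      }

    -- The special cases make the numerals 0, 1 and 2, 3, ... of a solved
    -- equation come out as 0#, 1# and ι 2, ι 3, ... rather than ι m - ι 0.
    ⟦_⟧ : ℕ × ℕ → Carrier
    ⟦ (a , 1+ b) ⟧ = ι a - ι (1+ b)
    ⟦ (zero , zero) ⟧ = 0#
    ⟦ (1+ zero , zero) ⟧ = 1#
    ⟦ (1+ (1+ a) , zero) ⟧ = ι (1+ (1+ a))

    -0#≈0# : - 0# ≈ 0#
    -0#≈0# = trans (sym (+-identityˡ (- 0#))) (-‿inverseʳ 0#)

    ⟦⟧≈difference : ∀ a b → ⟦ (a , b) ⟧ ≈ ι a - ι b
    ⟦⟧≈difference a (1+ b) = refl
    ⟦⟧≈difference zero zero = sym (-‿inverseʳ 0#)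
    ⟦⟧≈difference (1+ zero) zero = sym (trans (+-congˡ -0#≈0#) (trans (+-identityʳ _) (+-identityʳ _)))
    ⟦⟧≈difference (1+ (1+ a)) zero = sym (trans (+-congˡ -0#≈0#) (+-identityʳ _))

    -‿distrib-+ : ∀ a b c d → (a + c) - (b + d) ≈ (a - b) + (c - d)
    -‿distrib-+ a b c d = trans (+-congˡ (sym (⁻¹-∙-comm b d))) (interchange a c (- b) (- d))

    -‿distrib-* : ∀ a b c d → (a - b) * (c - d) ≈ (a * c + b * d) - (a * d + b * c)
    -‿distrib-* a b c d = begin
      (a - b) * (c - d)                         ≈⟨ [y-z]x≈yx-zx (c - d) a b ⟩
      a * (c - d) - b * (c - d)                 ≈⟨ +-cong (x[y-z]≈xy-xz a c d) (-‿cong (x[y-z]≈xy-xz b c d)) ⟩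
      (a * c - a * d) - (b * c - b * d)         ≈⟨ +-congˡ (⁻¹-anti-homo‿- (b * c) (b * d)) ⟩
      (a * c - a * d) + (b * d - b * c)         ≈⟨ -‿distrib-+ (a * c) (a * d) (b * d) (b * c) ⟨
      (a * c + b * d) - (a * d + b * c)         ∎

    -‿cancel-+ʳ : ∀ x y z → (x + z) - (y + z) ≈ x - y
    -‿cancel-+ʳ x y z = begin
      (x + z) - (y + z)   ≈⟨ -‿distrib-+ x y z z ⟩
      (x - y) + (z - z)   ≈⟨ +-congˡ (-‿inverseʳ z) ⟩
      (x - y) + 0#        ≈⟨ +-identityʳ _ ⟩
      x - y               ∎

    reduce-sound : ∀ a b → ι (a ℕ.∸ b) - ι (b ℕ.∸ a) ≈ ι a - ι b
    reduce-sound zero     zero     = refl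
    reduce-sound zero     (1+ b)   = refl
    reduce-sound (1+ a)   zero     = refl
    reduce-sound (1+ a)   (1+ b)   = begin
      ι (a ℕ.∸ b) - ι (b ℕ.∸ a)   ≈⟨ reduce-sound a b ⟩
      ι a - ι b                   ≈⟨ -‿cancel-+ʳ (ι a) (ι b) 1# ⟨
      (ι a + 1#) - (ι b + 1#)     ≈⟨ +-cong (+-comm _ _) (-‿cong (+-comm _ _)) ⟩
      ι (1+ a) - ι (1+ b)         ∎

    ⟦reduce⟧ : ∀ a b → ⟦ reduce (a , b) ⟧ ≈ ι a - ι b
    ⟦reduce⟧ a b = trans (⟦⟧≈difference (a ℕ.∸ b) (b ℕ.∸ a)) (reduce-sound a b)

    ACR-R : ACR.AlmostCommutativeRing c ℓ
    ACR-R = ACR.fromCommutativeRing R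

    homomorphism : ℤ-pairs ACR.-Raw-AlmostCommutative⟶ ACR-R
    homomorphism = record
      { ⟦_⟧ = ⟦_⟧
      ; +-homo = λ { (a , b) (c , d) → begin
          ⟦ reduce (a ℕ.+ c , b ℕ.+ d) ⟧      ≈⟨ ⟦reduce⟧ (a ℕ.+ c) (b ℕ.+ d) ⟩
          ι (a ℕ.+ c) - ι (b ℕ.+ d)          ≈⟨ +-cong (ι-homo-+ a c) (-‿cong (ι-homo-+ b d)) ⟩
          (ι a + ι c) - (ι b + ι d)          ≈⟨ -‿distrib-+ _ _ _ _ ⟩
          (ι a - ι b) + (ι c - ι d)          ≈⟨ +-cong (⟦⟧≈difference a b) (⟦⟧≈difference c d) ⟨
          ⟦ (a , b) ⟧ + ⟦ (c , d) ⟧          ∎ }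
      ; *-homo = λ { (a , b) (c , d) → begin
          ⟦ reduce (a ℕ.* c ℕ.+ b ℕ.* d , a ℕ.* d ℕ.+ b ℕ.* c) ⟧
            ≈⟨ ⟦reduce⟧ (a ℕ.* c ℕ.+ b ℕ.* d) (a ℕ.* d ℕ.+ b ℕ.* c) ⟩
          ι (a ℕ.* c ℕ.+ b ℕ.* d) - ι (a ℕ.* d ℕ.+ b ℕ.* c)
            ≈⟨ +-cong (ι-homo-+∘* a c b d) (-‿cong (ι-homo-+∘* a d b c)) ⟩
          (ι a * ι c + ι b * ι d) - (ι a * ι d + ι b * ι c)
            ≈⟨ -‿distrib-* _ _ _ _ ⟨
          (ι a - ι b) * (ι c - ι d)
            ≈⟨ *-cong (⟦⟧≈difference a b) (⟦⟧≈difference c d) ⟨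
          ⟦ (a , b) ⟧ * ⟦ (c , d) ⟧          ∎ }
      ; -‿homo = λ { (a , b) → begin
          ⟦ (b , a) ⟧      ≈⟨ ⟦⟧≈difference b a ⟩
          ι b - ι a        ≈⟨ ⁻¹-anti-homo‿- (ι a) (ι b) ⟨
          - (ι a - ι b)    ≈⟨ -‿cong (⟦⟧≈difference a b) ⟨
          - ⟦ (a , b) ⟧    ∎ }
      ; 0-homo = refl
      ; 1-homo = refl
      }
      where
      ι-homo-+∘* : ∀ a c b d → ι (a ℕ.* c ℕ.+ b ℕ.* d) ≈ ι a * ι c + ι b * ι d
      ι-homo-+∘* a c b d = trans (ι-homo-+ (a ℕ.* c) (b ℕ.* d)) (+-cong (ι-homo-* a c) (ι-homo-* b d))

    equal? : ∀ p q → Maybe (⟦ p ⟧ ≈ ⟦ q ⟧)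
    equal? (a , b) (c , d) with a ℕ.+ d ℕ.≟ c ℕ.+ b
    ... | no _  = nothing
    ... | yes e = just (begin
      ⟦ (a , b) ⟧                 ≈⟨ ⟦⟧≈difference a b ⟩
      ι a - ι b                   ≈⟨ -‿cancel-+ʳ (ι a) (ι b) (ι d) ⟨
      (ι a + ι d) - (ι b + ι d)   ≈⟨ +-cong (ι-+ a d c b e) (-‿cong (+-comm _ _)) ⟩
      (ι c + ι b) - (ι d + ι b)   ≈⟨ -‿cancel-+ʳ (ι c) (ι d) (ι b) ⟩
      ι c - ι d                   ≈⟨ ⟦⟧≈difference c d ⟨
      ⟦ (c , d) ⟧                 ∎)
      where
      ι-+ : ∀ a d c b → a ℕ.+ d ≡ c ℕ.+ b → ι a + ι d ≈ ι c + ι b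
      ι-+ a d c b e = trans (sym (ι-homo-+ a d)) (trans (reflexive (≡.cong ι e)) (ι-homo-+ c b))

  open Algebra.Solver.Ring ℤ-pairs ACR-R homomorphism equal? public

  κ : ∀ {m} → ℕ → Polynomial m
  κ k = con (k , 0)

module FieldLemmas {c ℓ} (F : CharZeroField c ℓ) where
  open Ops F public
  open IntegerRingSolver commRing public
    hiding (ι; ι-homo-+) renaming (ι-homo-* to nat-homo-*)
  open import Relation.Binary.Reasoning.Setoid setoid public
  open Algebra.Properties.CommutativeSemigroup *-commutativeSemigroup
    public using () renaming (interchange to *-interchange)
  open Algebra.Properties.CommutativeSemigroup +-commutativeSemigroup
    public using () renaming (interchange to +-interchange)

  ≉0-resp : ∀ {a b} → a ≈ b → b ≉ 0# → a ≉ 0#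
  ≉0-resp a≈b b≉0 a≈0 = b≉0 (trans (sym a≈b) a≈0)

  *-≉0⇒≉0ˡ : ∀ {a b} → a * b ≉ 0# → a ≉ 0#
  *-≉0⇒≉0ˡ ab≉0 a≈0 = ab≉0 (trans (*-congʳ a≈0) (zeroˡ _))

  1#≉0 : 1# ≉ 0#
  1#≉0 1≈0 = 0≉1 (sym 1≈0)

  nat-≉0 : ∀ n → .{{NonZero n}} → nat n ≉ 0#
  nat-≉0 (1+ m) = char-zero m

  inv-unique : ∀ {a b} → a ≉ 0# → a * b ≈ 1# → inv a ≈ b
  inv-unique {a} {b} a≉0 ab≈1 = begin
    inv a              ≈⟨ *-identityʳ _ ⟨
    inv a * 1#         ≈⟨ *-congˡ ab≈1 ⟨
    inv a * (a * b)    ≈⟨ *-assoc _ _ _ ⟨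
    (inv a * a) * b    ≈⟨ *-congʳ (trans (*-comm _ _) (inv-nonzero a a≉0)) ⟩
    1# * b             ≈⟨ *-identityˡ _ ⟩
    b                  ∎

  inv-≉0 : ∀ {a} → a ≉ 0# → inv a ≉ 0#
  inv-≉0 {a} a≉0 inv-a≈0 = 0≉1 (begin
    0#           ≈⟨ zeroʳ a ⟨
    a * 0#       ≈⟨ *-congˡ inv-a≈0 ⟨
    a * inv a    ≈⟨ inv-nonzero a a≉0 ⟩
    1#           ∎)

  *-inverses : ∀ {a b} → a ≉ 0# → b ≉ 0# → (a * b) * (inv a * inv b) ≈ 1#
  *-inverses {a} {b} a≉0 b≉0 = begin
    (a * b) * (inv a * inv b)    ≈⟨ *-interchange a b (inv a) (inv b) ⟩
    (a * inv a) * (b * inv b)    ≈⟨ *-cong (inv-nonzero a a≉0) (inv-nonzero b b≉0) ⟩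
    1# * 1#                      ≈⟨ *-identityˡ _ ⟩
    1#                           ∎

  *-≉0 : ∀ {a b} → a ≉ 0# → b ≉ 0# → a * b ≉ 0#
  *-≉0 a≉0 b≉0 ab≈0 =
    0≉1 (trans (sym (zeroˡ _)) (trans (*-congʳ (sym ab≈0)) (*-inverses a≉0 b≉0)))

  inv-distrib-* : ∀ {a b} → a ≉ 0# → b ≉ 0# → inv (a * b) ≈ inv a * inv b
  inv-distrib-* a≉0 b≉0 = inv-unique (*-≉0 a≉0 b≉0) (*-inverses a≉0 b≉0)

  *-cancelˡ : ∀ {a x y} → a ≉ 0# → a * x ≈ a * y → x ≈ y
  *-cancelˡ {a} {x} {y} a≉0 ax≈ay = begin
    x                  ≈⟨ *-identityˡ x ⟨
    1# * x             ≈⟨ *-congʳ (trans (*-comm _ _) (inv-nonzero a a≉0)) ⟨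
    (inv a * a) * x    ≈⟨ *-assoc _ _ _ ⟩
    inv a * (a * x)    ≈⟨ *-congˡ ax≈ay ⟩
    inv a * (a * y)    ≈⟨ *-assoc _ _ _ ⟨
    (inv a * a) * y    ≈⟨ *-congʳ (trans (*-comm _ _) (inv-nonzero a a≉0)) ⟩
    1# * y             ≈⟨ *-identityˡ y ⟩
    y                  ∎

  ÷-*-÷ : ∀ a {b} c {d} → b ≉ 0# → d ≉ 0# → (a ÷ b) * (c ÷ d) ≈ (a * c) ÷ (b * d)
  ÷-*-÷ a {b} c {d} b≉0 d≉0 = begin
    (a * inv b) * (c * inv d)   ≈⟨ *-interchange a (inv b) c (inv d) ⟩
    (a * c) * (inv b * inv d)   ≈⟨ *-congˡ (inv-distrib-* b≉0 d≉0) ⟨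
    (a * c) * inv (b * d)       ∎

  ÷-*-inv : ∀ a {b d} → b ≉ 0# → d ≉ 0# → (a ÷ b) * inv d ≈ a ÷ (b * d)
  ÷-*-inv a b≉0 d≉0 = trans (*-assoc _ _ _) (*-congˡ (sym (inv-distrib-* b≉0 d≉0)))

  ÷-cancelʳ : ∀ a {b c} → b ≉ 0# → c ≉ 0# → (a * c) ÷ (b * c) ≈ a ÷ b
  ÷-cancelʳ a {b} {c} b≉0 c≉0 = begin
    (a * c) * inv (b * c)       ≈⟨ *-congˡ (inv-distrib-* b≉0 c≉0) ⟩
    (a * c) * (inv b * inv c)   ≈⟨ *-interchange a c (inv b) (inv c) ⟩
    (a * inv b) * (c * inv c)   ≈⟨ *-congˡ (inv-nonzero c c≉0) ⟩
    (a * inv b) * 1#            ≈⟨ *-identityʳ _ ⟩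
    a * inv b                   ∎

  ÷-rescale : ∀ {a b} e {d n} → d ≉ 0# → b * e ≈ d → a * e ≈ n → a ÷ b ≈ n ÷ d
  ÷-rescale {a} {b} e {d} {n} d≉0 be≈d ae≈n = begin
    a * inv b                         ≈⟨ ÷-cancelʳ a b≉0 e≉0 ⟨
    (a * e) * inv (b * e)             ≈⟨ *-cong ae≈n (inv-cong be≈d) ⟩
    n * inv d                         ∎
    where
    be≉0 : b * e ≉ 0#
    be≉0 = ≉0-resp be≈d d≉0
    b≉0 : b ≉ 0#
    b≉0 = *-≉0⇒≉0ˡ be≉0
    e≉0 : e ≉ 0#
    e≉0 = *-≉0⇒≉0ˡ (≉0-resp (*-comm e b) be≉0)

  Σ< : ℕ → (ℕ → Carrier) → Carrier
  Σ< zero   f = 0#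
  Σ< (1+ k) f = Σ< k f + f k

  Σ<-cong : ∀ k {f g : ℕ → Carrier} → (∀ i → i < k → f i ≈ g i) → Σ< k f ≈ Σ< k g
  Σ<-cong zero   f≈g = refl
  Σ<-cong (1+ k) f≈g = +-cong (Σ<-cong k (λ i i<k → f≈g i (ℕ.m<n⇒m<1+n i<k))) (f≈g k ℕ.≤-refl)

  Σ<-suc : ∀ k (f : ℕ → Carrier) → Σ< (1+ k) f ≈ f 0 + Σ< k (λ i → f (1+ i))
  Σ<-suc zero   f = trans (+-identityˡ _) (sym (+-identityʳ _))
  Σ<-suc (1+ k) f = trans (+-congʳ (Σ<-suc k f)) (+-assoc _ _ _)

  Σ<-- : ∀ k (f g : ℕ → Carrier) → Σ< k f - Σ< k g ≈ Σ< k (λ i → f i - g i)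
  Σ<-- zero   f g = -‿inverseʳ 0#
  Σ<-- (1+ k) f g = trans (-‿distrib-+ (Σ< k f) (Σ< k g) (f k) (g k)) (+-congʳ (Σ<-- k f g))
    where
    -‿distrib-+ : ∀ a b c d → (a + c) - (b + d) ≈ (a - b) + (c - d)
    -‿distrib-+ = solve 4 (λ a b c d → (a :+ c) :- (b :+ d) := (a :- b) :+ (c :- d)) refl

  sum1≈Σ< : ∀ m (f : ℕ → Carrier) → sum1 m f ≈ Σ< m (λ i → f (1+ i))
  sum1≈Σ< zero   f = refl
  sum1≈Σ< (1+ m) f = +-congʳ (sum1≈Σ< m f)

  sumTo-cong : ∀ m {f g : ℕ → Carrier} → (∀ k → k ≤ m → f k ≈ g k) → sumTo m f ≈ sumTo m g
  sumTo-cong zero   f≈g = f≈g 0 z≤n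
  sumTo-cong (1+ m) f≈g = +-cong (sumTo-cong m (λ k k≤m → f≈g k (ℕ.m≤n⇒m≤1+n k≤m))) (f≈g (1+ m) ℕ.≤-refl)

  sumTo-+ : ∀ m (f g : ℕ → Carrier) → sumTo m (λ k → f k + g k) ≈ sumTo m f + sumTo m g
  sumTo-+ zero   f g = refl
  sumTo-+ (1+ m) f g = trans (+-congʳ (sumTo-+ m f g)) (+-interchange _ _ _ _)

  sumTo-*ˡ : ∀ m a (f : ℕ → Carrier) → sumTo m (λ k → a * f k) ≈ a * sumTo m f
  sumTo-*ˡ zero   a f = refl
  sumTo-*ˡ (1+ m) a f = trans (+-congʳ (sumTo-*ˡ m a f)) (sym (distribˡ _ _ _))

  sumTo-telescope : ∀ m (h : ℕ → Carrier) → sumTo m (λ k → h (1+ k) - h k) ≈ h (1+ m) - h 0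
  sumTo-telescope zero   h = refl
  sumTo-telescope (1+ m) h = trans (+-congʳ (sumTo-telescope m h))
    (solve 3 (λ a b c → (b :- a) :+ (c :- b) := c :- a) refl (h 0) (h (1+ m)) (h (1+ (1+ m))))

  prod-cong : ∀ k {f g : ℕ → Carrier} → (∀ i → i < k → f i ≈ g i) → prod k f ≈ prod k g
  prod-cong zero   f≈g = refl
  prod-cong (1+ k) f≈g = *-cong (prod-cong k (λ i i<k → f≈g i (ℕ.m<n⇒m<1+n i<k))) (f≈g k ℕ.≤-refl)

  prod-suc : ∀ k (f : ℕ → Carrier) → prod (1+ k) f ≈ f 0 * prod k (λ i → f (1+ i))
  prod-suc zero   f = *-comm _ _
  prod-suc (1+ k) f = trans (*-congʳ (prod-suc k f)) (*-assoc _ _ _)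

  prod-≉0 : ∀ k (f : ℕ → Carrier) → (∀ i → i < k → f i ≉ 0#) → prod k f ≉ 0#
  prod-≉0 zero   f f≉0 = 1#≉0
  prod-≉0 (1+ k) f f≉0 = *-≉0 (prod-≉0 k f (λ i i<k → f≉0 i (ℕ.m<n⇒m<1+n i<k))) (f≉0 k ℕ.≤-refl)

  prod-≉0⇒≉0 : ∀ k (f : ℕ → Carrier) → prod k f ≉ 0# → ∀ i → i < k → f i ≉ 0#
  prod-≉0⇒≉0 (1+ k) f ∏≉0 i i<1+k fi≈0 with i ℕ.≟ k
  ... | yes ≡.refl = ∏≉0 (trans (*-congˡ fi≈0) (zeroʳ _))
  ... | no  i≢k    = prod-≉0⇒≉0 k f (*-≉0⇒≉0ˡ ∏≉0) i (ℕ.≤∧≢⇒< (ℕ.≤-pred i<1+k) i≢k) fi≈0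

module Binomials {c ℓ} (F : CharZeroField c ℓ) where
  open FieldLemmas F public

  rising : Carrier → ℕ → Carrier
  rising z k = prod k (λ i → z + nat i)

  rising-cong : ∀ {z w} k → z ≈ w → rising z k ≈ rising w k
  rising-cong k z≈w = prod-cong k (λ i _ → +-congʳ z≈w)

  rising-suc : ∀ z k → rising z (1+ k) ≈ z * rising (z + 1#) k
  rising-suc z k = trans (prod-suc k (λ i → z + nat i))
    (*-cong (+-identityʳ z) (prod-cong k (λ i _ → sym (+-assoc z 1# (nat i)))))

  rising-≉0 : ∀ z k → (∀ i → i < k → z + nat i ≉ 0#) → rising z k ≉ 0#
  rising-≉0 z k = prod-≉0 k (λ i → z + nat i)

  falling≈rising : ∀ z k → prod k (λ i → z + nat k - nat i) ≈ rising (z + 1#) k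
  falling≈rising z zero   = refl
  falling≈rising z (1+ k) = begin
    prod k (λ i → z + nat (1+ k) - nat i) * (z + nat (1+ k) - nat k)
      ≈⟨ *-cong (prod-cong k (λ i _ → +-congʳ (z+[1+k]≈[z+1]+k z k))) (z+[1+k]-k≈z+1 z k) ⟩
    prod k (λ i → z + 1# + nat k - nat i) * (z + 1#)
      ≈⟨ *-congʳ (falling≈rising (z + 1#) k) ⟩
    rising (z + 1# + 1#) k * (z + 1#)
      ≈⟨ trans (rising-suc (z + 1#) k) (*-comm _ _) ⟨
    rising (z + 1#) (1+ k) ∎
    where
    z+[1+k]≈[z+1]+k : ∀ z k → z + nat (1+ k) ≈ z + 1# + nat k
    z+[1+k]≈[z+1]+k z k = solve 2 (λ z k → z :+ (κ 1 :+ k) := z :+ κ 1 :+ k) refl z (nat k)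
    z+[1+k]-k≈z+1 : ∀ z k → z + nat (1+ k) - nat k ≈ z + 1#
    z+[1+k]-k≈z+1 z k = solve 2 (λ z k → z :+ (κ 1 :+ k) :- k := z :+ κ 1) refl z (nat k)

  k!≉0 : ∀ k → nat (k ℕ.!) ≉ 0#
  k!≉0 k = nat-≉0 (k ℕ.!) {{k ℕ.!≢0}}

  binom-zero : ∀ z → binom z 0 ≈ 1#
  binom-zero z = trans (*-identityˡ _) (inv-unique (nat-≉0 1) (trans (*-identityʳ _) (+-identityʳ 1#)))

  binom-rising : ∀ z k → binom (z + nat k) k ≈ rising (z + 1#) k ÷ nat (k ℕ.!)
  binom-rising z k = *-congʳ (falling≈rising z k)

  suc-*-binom-suc : ∀ z k → nat (1+ k) * binom z (1+ k) ≈ prod (1+ k) (λ i → z - nat i) ÷ nat (k ℕ.!)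
  suc-*-binom-suc z k = begin
    nat (1+ k) * (p * inv (nat (1+ k ℕ.!)))
      ≈⟨ *-congˡ (*-congˡ (inv-cong (nat-homo-* (1+ k) (k ℕ.!)))) ⟩
    nat (1+ k) * (p * inv (nat (1+ k) * nat (k ℕ.!)))
      ≈⟨ *-congˡ (*-congˡ (inv-distrib-* (nat-≉0 (1+ k)) (k!≉0 k))) ⟩
    nat (1+ k) * (p * (inv (nat (1+ k)) * inv (nat (k ℕ.!))))
      ≈⟨ solve 4 (λ m p i j → m :* (p :* (i :* j)) := (m :* i) :* (p :* j)) refl (nat (1+ k)) p _ _ ⟩
    (nat (1+ k) * inv (nat (1+ k))) * (p * inv (nat (k ℕ.!)))
      ≈⟨ *-congʳ (inv-nonzero _ (nat-≉0 (1+ k))) ⟩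
    1# * (p * inv (nat (k ℕ.!)))
      ≈⟨ *-identityˡ _ ⟩
    p * inv (nat (k ℕ.!)) ∎
    where
    p : Carrier
    p = prod (1+ k) (λ i → z - nat i)

  binom-suc : ∀ z k → nat (1+ k) * binom z (1+ k) ≈ (z - nat k) * binom z k
  binom-suc z k = trans (suc-*-binom-suc z k)
    (solve 3 (λ p w i → (p :* w) :* i := w :* (p :* i)) refl (prod k (λ i → z - nat i)) (z - nat k) _)

  binom-absorb : ∀ z k → nat (1+ k) * binom (1# + z) (1+ k) ≈ (1# + z) * binom z k
  binom-absorb z k = begin
    nat (1+ k) * binom (1# + z) (1+ k)
      ≈⟨ suc-*-binom-suc (1# + z) k ⟩
    prod (1+ k) (λ i → 1# + z - nat i) ÷ nat (k ℕ.!)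
      ≈⟨ *-congʳ (prod-suc k (λ i → 1# + z - nat i)) ⟩
    ((1# + z - 0#) * prod k (λ i → 1# + z - nat (1+ i))) ÷ nat (k ℕ.!)
      ≈⟨ *-congʳ (*-cong (solve 1 (λ z → κ 1 :+ z :- κ 0 := κ 1 :+ z) refl z)
                          (prod-cong k (λ i _ → solve 2 (λ z i → κ 1 :+ z :- (κ 1 :+ i) := z :- i) refl z (nat i)))) ⟩
    ((1# + z) * prod k (λ i → z - nat i)) ÷ nat (k ℕ.!)
      ≈⟨ *-assoc _ _ _ ⟩
    (1# + z) * binom z k ∎

  binom-nat-suc : ∀ n → binom (nat n) (1+ n) ≈ 0#
  binom-nat-suc n = begin
    (prod n (λ i → nat n - nat i) * (nat n - nat n)) * inv (nat (1+ n ℕ.!))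
      ≈⟨ *-congʳ (trans (*-congˡ (-‿inverseʳ (nat n))) (zeroʳ _)) ⟩
    0# * inv (nat (1+ n ℕ.!))
      ≈⟨ zeroˡ _ ⟩
    0# ∎

  binom-nat-diagonal : ∀ n → binom (nat (1+ n)) (1+ n) ≈ binom (nat n) n
  binom-nat-diagonal n = *-cancelˡ (nat-≉0 (1+ n)) (binom-absorb (nat n) n)

module WellPoisedSum {c ℓ} (F : CharZeroField c ℓ) (β γ : CharZeroField.Carrier F) where
  open Binomials F

  t-num t-den t : ℕ → Carrier → ℕ → Carrier
  t-num n A k = sign k * binom (nat n) k * rising A k * rising β k * rising γ k * (A + nat 2 * nat k)
  t-den n A k = rising (A + 1# - β) k * rising (A + 1# - γ) k * rising (A + nat n) (1+ k)
  t n A k = t-num n A k ÷ t-den n A k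

  g-num g-den : ℕ → Carrier → ℕ → Carrier
  g-num n A j = sign j * binom (nat n) j * rising A (1+ j) * rising β (1+ j) * rising γ (1+ j)
  g-den n A j = rising (A + 1# - β) (1+ j) * rising (A + 1# - γ) (1+ j) * rising (A + nat (1+ n)) (1+ j)

  g : ℕ → Carrier → ℕ → Carrier
  g n A zero   = 0#
  g n A (1+ j) = g-num n A j ÷ g-den n A j

  ρ ρ′ : Carrier → Carrier
  ρ  A = (A * (A + 1# - β - γ)) ÷ ((A + 1# - β) * (A + 1# - γ))
  ρ′ A = (- (A * β)) ÷ ((A + 1# - β) * ((A + 1# - γ) * (A + 1# - γ)))

  R : ℕ → Carrier → Carrier
  R n A = (rising A n * rising (A + 1# - β - γ) n) ÷ (rising (A + 1# - β) n * rising (A + 1# - γ) n)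

  -- δt A k and δR n A are the logarithmic derivatives in γ of t n A k and R n A,
  -- and ρ′ A is the derivative of ρ A.
  δt : Carrier → ℕ → Carrier
  δt A k = Σ< k (λ i → inv (γ + nat i) + inv (A + 1# - γ + nat i))

  δR : ℕ → Carrier → Carrier
  δR n A = Σ< n (λ i → inv (A + 1# - γ + nat i) - inv (A + 1# - β - γ + nat i))

  Contiguity Contiguity′ : ℕ → Carrier → ℕ → Set ℓ
  Contiguity n A k = t (1+ n) A k ≈ ρ A * t n (A + 1#) k + (g n A (1+ k) - g n A k)
  Contiguity′ n A k =
    ρ′ A * t n (A + 1#) k + ρ A * t n (A + 1#) k * (inv (A + 1# - γ + nat k) - inv (A + 1# - γ))
      + g n A (1+ k) * (inv (γ + nat k) + inv (A + 1# - γ + nat k)) ≈ 0#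

  rising-one : ∀ z → rising z 1 ≈ z
  rising-one z = trans (*-identityˡ _) (+-identityʳ z)

  t-zero : ∀ n A → t n A 0 ≈ A ÷ (A + nat n)
  t-zero n A = *-cong
    (trans (solve 2 (λ A b → κ 1 :* b :* κ 1 :* κ 1 :* κ 1 :* (A :+ κ 2 :* κ 0) := b :* A) refl A (binom (nat n) 0))
           (trans (*-congʳ (binom-zero (nat n))) (*-identityˡ A)))
    (inv-cong (trans (*-congʳ (*-identityˡ 1#)) (trans (*-identityˡ _) (rising-one (A + nat n)))))

  g-one : ∀ n A → g n A 1 ≈ (A * β * γ) ÷ ((A + 1# - β) * (A + 1# - γ) * (A + nat (1+ n)))
  g-one n A = *-cong
    (trans (solve 4 (λ A b c C →
               κ 1 :* C :* (κ 1 :* (A :+ κ 0)) :* (κ 1 :* (b :+ κ 0)) :* (κ 1 :* (c :+ κ 0))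
               := C :* (A :* b :* c))
             refl A β γ (binom (nat n) 0))
           (trans (*-congʳ (binom-zero (nat n))) (*-identityˡ _)))
    (inv-cong (*-cong (*-cong (rising-one _) (rising-one _)) (rising-one _)))

  shift-base : ∀ A b → A + 1# - b + 1# ≈ A + 1# + 1# - b
  shift-base A b = solve 2 (λ A b → A :+ κ 1 :- b :+ κ 1 := A :+ κ 1 :+ κ 1 :- b) refl A b

  shift-index : ∀ A b i → A + 1# + 1# - b + nat i ≈ A + 1# - b + nat (1+ i)
  shift-index A b i = solve 3 (λ A b i → A :+ κ 1 :+ κ 1 :- b :+ i := A :+ κ 1 :- b :+ (κ 1 :+ i)) refl A b (nat i)

  shift-index-βγ : ∀ A i → A + 1# + 1# - β - γ + nat i ≈ A + 1# - β - γ + nat (1+ i)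
  shift-index-βγ A i = solve 4 (λ A b c i → A :+ κ 1 :+ κ 1 :- b :- c :+ i := A :+ κ 1 :- b :- c :+ (κ 1 :+ i)) refl A β γ (nat i)

  module LinearFactors {m} (A b g J N : Polynomial m) where
    lc mb mc n2 j1 c1 aJ bJ1 abc w0 wT : Polynomial m
    lc = A :+ κ 1 :- g
    mb = A :+ κ 1 :+ κ 1 :- b :+ J
    mc = A :+ κ 1 :+ κ 1 :- g :+ J
    n2 = A :+ κ 1 :+ N :+ (κ 1 :+ J)
    j1 = κ 1 :+ J
    c1 = g :+ (κ 1 :+ J)
    aJ = A :+ κ 1 :+ J
    bJ1 = b :+ (κ 1 :+ J)
    abc = A :+ κ 1 :- b :- g
    w0 = A :+ κ 1 :+ κ 2 :* (κ 1 :+ J)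
    wT = A :+ κ 2 :* (κ 1 :+ J)

  module Interior (n : ℕ) (A : Carrier) (j : ℕ) where
    J N sj Cj Cj1 C′ Pa Pb Pc Qb Qc Qn lb lc mb mc n1 n2 j1 c1 bJ cJ aJ bJ1 abc w0 wT : Carrier
    J = nat j
    N = nat n
    sj = sign j
    Cj = binom (nat n) j
    Cj1 = binom (nat n) (1+ j)
    C′ = binom (nat (1+ n)) (1+ j)
    Pa = rising (A + 1#) j
    Pb = rising β j
    Pc = rising γ j
    Qb = rising (A + 1# + 1# - β) j
    Qc = rising (A + 1# + 1# - γ) j
    Qn = rising (A + 1# + nat n) j
    lb = A + 1# - β
    lc = A + 1# - γ
    mb = A + 1# + 1# - β + J
    mc = A + 1# + 1# - γ + J
    n1 = A + 1# + N + J
    n2 = A + 1# + N + (1# + J)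
    j1 = 1# + J
    c1 = γ + (1# + J)
    bJ = β + J
    cJ = γ + J
    aJ = A + 1# + J
    bJ1 = β + (1# + J)
    abc = A + 1# - β - γ
    w0 = A + 1# + nat 2 * (1# + J)
    wT = A + nat 2 * (1# + J)

    -- All terms at index 1 + j are written over the common denominator Q * L
    -- with numerators Y * Z₁ * r (for Contiguity) or Y * Z₂ * r (for Contiguity′).
    L Q Dn Y Z₁ Z₂ : Carrier
    L = lb * lc * lc * mb * mc * mc * n1 * n2 * j1 * c1
    Q = Qb * Qc * Qn
    Dn = Q * L
    Y = sj * Pa * Pb * Pc
    Z₁ = A * bJ * cJ * lc * mc * c1
    Z₂ = A * aJ * bJ * cJ

    rising-lb : rising (A + 1# - β) (1+ j) ≈ lb * Qb
    rising-lb = trans (rising-suc lb j) (*-congˡ (rising-cong j (shift-base A β)))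
    rising-lc : rising (A + 1# - γ) (1+ j) ≈ lc * Qc
    rising-lc = trans (rising-suc lc j) (*-congˡ (rising-cong j (shift-base A γ)))
    rising-n : rising (A + nat (1+ n)) j ≈ Qn
    rising-n = rising-cong j (sym (+-assoc A 1# N))
    n1≈ : A + nat (1+ n) + J ≈ n1
    n1≈ = +-congʳ (sym (+-assoc A 1# N))
    n2≈ : A + nat (1+ n) + (1# + J) ≈ n2
    n2≈ = +-congʳ (sym (+-assoc A 1# N))
    mb≈ : A + 1# - β + (1# + J) ≈ mb
    mb≈ = sym (shift-index A β j)
    mc≈ : A + 1# - γ + (1# + J) ≈ mc
    mc≈ = sym (shift-index A γ j)
    rising-n-2 : rising (A + nat (1+ n)) (1+ (1+ j)) ≈ Qn * n1 * n2
    rising-n-2 = *-cong (*-cong rising-n n1≈) n2≈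

    t₁-den : t-den (1+ n) A (1+ j) ≈ (lb * Qb) * (lc * Qc) * (Qn * n1 * n2)
    t₁-den = *-cong (*-cong rising-lb rising-lc) rising-n-2
    t₁-num : t-num (1+ n) A (1+ j) ≈ - sj * C′ * (A * Pa) * (Pb * bJ) * (Pc * cJ) * wT
    t₁-num = *-congʳ (*-congʳ (*-congʳ (*-congˡ (rising-suc A j))))
    g₁-den : g-den n A (1+ j) ≈ (lb * Qb * mb) * (lc * Qc * mc) * (Qn * n1 * n2)
    g₁-den = *-cong (*-cong (*-cong rising-lb mb≈) (*-cong rising-lc mc≈)) rising-n-2
    g₁-num : g-num n A (1+ j) ≈ - sj * Cj1 * (A * Pa * aJ) * (Pb * bJ * bJ1) * (Pc * cJ * c1)
    g₁-num = *-congʳ (*-congʳ (*-congˡ (*-cong (rising-suc A j) (sym (+-assoc A 1# J)))))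

    module _ (Qb≉0 : Qb ≉ 0#) (Qc≉0 : Qc ≉ 0#) (Qn≉0 : Qn ≉ 0#) (lb≉0 : lb ≉ 0#) (lc≉0 : lc ≉ 0#)
             (mb≉0 : mb ≉ 0#) (mc≉0 : mc ≉ 0#) (n1≉0 : n1 ≉ 0#) (n2≉0 : n2 ≉ 0#) (c1≉0 : c1 ≉ 0#) where
      Dn≉0 : Dn ≉ 0#
      Dn≉0 = *-≉0 (*-≉0 (*-≉0 Qb≉0 Qc≉0) Qn≉0)
        (*-≉0 (*-≉0 (*-≉0 (*-≉0 (*-≉0 (*-≉0 (*-≉0 (*-≉0 (*-≉0 lb≉0 lc≉0) lc≉0) mb≉0) mc≉0) mc≉0)
          n1≉0) n2≉0) (nat-≉0 (1+ j))) c1≉0)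
      t₀-den≉0 : t-den n (A + 1#) (1+ j) ≉ 0#
      t₀-den≉0 = *-≉0 (*-≉0 (*-≉0 Qb≉0 mb≉0) (*-≉0 Qc≉0 mc≉0)) (*-≉0 (*-≉0 Qn≉0 n1≉0) n2≉0)
      ρ-den≉0 : lb * lc ≉ 0#
      ρ-den≉0 = *-≉0 lb≉0 lc≉0
      g₁-den≉0 : g-den n A (1+ j) ≉ 0#
      g₁-den≉0 = ≉0-resp g₁-den
        (*-≉0 (*-≉0 (*-≉0 (*-≉0 lb≉0 Qb≉0) mb≉0) (*-≉0 (*-≉0 lc≉0 Qc≉0) mc≉0)) (*-≉0 (*-≉0 Qn≉0 n1≉0) n2≉0))

      r-t₁ r-ρt₀ r-g₁ r-g₀ : Carrier
      r-t₁ = - (wT * mb * mc) * ((1# + N) * Cj)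
      r-ρt₀ = - (abc * aJ * w0) * ((N - J) * Cj)
      r-g₁ = - (aJ * bJ1 * c1) * ((N - J) * Cj)
      r-g₀ = mb * mc * n2 * j1 * Cj

      t₁≈ : t (1+ n) A (1+ j) ≈ (Y * Z₁ * r-t₁) ÷ Dn
      t₁≈ = ÷-rescale (lc * mb * mc * mc * j1 * c1) Dn≉0
        (trans (*-congʳ t₁-den) (solve 11 (λ lb Qb lc Qc Qn n1 n2 mb mc j1 c1 →
                                    (lb :* Qb) :* (lc :* Qc) :* (Qn :* n1 :* n2) :* (lc :* mb :* mc :* mc :* j1 :* c1)
                                    := (Qb :* Qc :* Qn) :* (lb :* lc :* lc :* mb :* mc :* mc :* n1 :* n2 :* j1 :* c1))
                                  refl lb Qb lc Qc Qn n1 n2 mb mc j1 c1))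
        (trans (*-congʳ t₁-num) (trans
           (solve 14 (λ sj C A Pa Pb bJ Pc cJ wT lc mb mc j1 c1 →
               :-_ sj :* C :* (A :* Pa) :* (Pb :* bJ) :* (Pc :* cJ) :* wT :* (lc :* mb :* mc :* mc :* j1 :* c1)
               := (sj :* Pa :* Pb :* Pc) :* (A :* bJ :* cJ :* lc :* mc :* c1) :* (:-_ (wT :* mb :* mc) :* (j1 :* C)))
             refl sj C′ A Pa Pb bJ Pc cJ wT lc mb mc j1 c1)
           (*-congˡ (*-congˡ (binom-absorb (nat n) j)))))

      ρt₀≈ : ρ A * t n (A + 1#) (1+ j) ≈ (Y * Z₁ * r-ρt₀) ÷ Dn
      ρt₀≈ = trans (÷-*-÷ _ _ ρ-den≉0 t₀-den≉0) (÷-rescale (lc * mc * j1 * c1) Dn≉0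
        (solve 11 (λ lb Qb lc Qc Qn n1 n2 mb mc j1 c1 →
            lb :* lc :* (Qb :* mb :* (Qc :* mc) :* (Qn :* n1 :* n2)) :* (lc :* mc :* j1 :* c1)
            := (Qb :* Qc :* Qn) :* (lb :* lc :* lc :* mb :* mc :* mc :* n1 :* n2 :* j1 :* c1))
          refl lb Qb lc Qc Qn n1 n2 mb mc j1 c1)
        (trans (solve 15 (λ sj Cj1 A abc Pa aJ Pb bJ Pc cJ w0 lc mc j1 c1 →
                   A :* abc :* (:-_ sj :* Cj1 :* (Pa :* aJ) :* (Pb :* bJ) :* (Pc :* cJ) :* w0) :* (lc :* mc :* j1 :* c1)
                   := (sj :* Pa :* Pb :* Pc) :* (A :* bJ :* cJ :* lc :* mc :* c1) :* (:-_ (abc :* aJ :* w0) :* (j1 :* Cj1)))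
                 refl sj Cj1 A abc Pa aJ Pb bJ Pc cJ w0 lc mc j1 c1)
           (*-congˡ (*-congˡ (binom-suc (nat n) j)))))

      g₁≈ : g n A (1+ (1+ j)) ≈ (Y * Z₁ * r-g₁) ÷ Dn
      g₁≈ = ÷-rescale (lc * mc * j1 * c1) Dn≉0
        (trans (*-congʳ g₁-den)
          (solve 11 (λ lb Qb lc Qc Qn n1 n2 mb mc j1 c1 →
              lb :* Qb :* mb :* (lc :* Qc :* mc) :* (Qn :* n1 :* n2) :* (lc :* mc :* j1 :* c1)
              := (Qb :* Qc :* Qn) :* (lb :* lc :* lc :* mb :* mc :* mc :* n1 :* n2 :* j1 :* c1))
            refl lb Qb lc Qc Qn n1 n2 mb mc j1 c1))
        (trans (*-congʳ g₁-num)
          (trans (solve 14 (λ sj Cj1 A Pa aJ Pb bJ bJ1 Pc cJ lc mc j1 c1 →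
                     :-_ sj :* Cj1 :* (A :* Pa :* aJ) :* (Pb :* bJ :* bJ1) :* (Pc :* cJ :* c1) :* (lc :* mc :* j1 :* c1)
                     := (sj :* Pa :* Pb :* Pc) :* (A :* bJ :* cJ :* lc :* mc :* c1) :* (:-_ (aJ :* bJ1 :* c1) :* (j1 :* Cj1)))
                   refl sj Cj1 A Pa aJ Pb bJ bJ1 Pc cJ lc mc j1 c1)
           (*-congˡ (*-congˡ (binom-suc (nat n) j)))))

      g₀≈ : g n A (1+ j) ≈ (Y * Z₁ * r-g₀) ÷ Dn
      g₀≈ = ÷-rescale (lc * mb * mc * mc * n2 * j1 * c1) Dn≉0
        (trans (*-congʳ (*-cong (*-cong rising-lb rising-lc) (*-cong rising-n n1≈)))
          (solve 11 (λ lb Qb lc Qc Qn n1 n2 mb mc j1 c1 →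
              lb :* Qb :* (lc :* Qc) :* (Qn :* n1) :* (lc :* mb :* mc :* mc :* n2 :* j1 :* c1)
              := (Qb :* Qc :* Qn) :* (lb :* lc :* lc :* mb :* mc :* mc :* n1 :* n2 :* j1 :* c1))
            refl lb Qb lc Qc Qn n1 n2 mb mc j1 c1))
        (trans (*-congʳ (*-congʳ (*-congʳ (*-congˡ (rising-suc A j)))))
          (solve 14 (λ sj Cj A Pa Pb bJ Pc cJ lc mb mc n2 j1 c1 →
              sj :* Cj :* (A :* Pa) :* (Pb :* bJ) :* (Pc :* cJ) :* (lc :* mb :* mc :* mc :* n2 :* j1 :* c1)
              := (sj :* Pa :* Pb :* Pc) :* (A :* bJ :* cJ :* lc :* mc :* c1) :* (mb :* mc :* n2 :* j1 :* Cj))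
            refl sj Cj A Pa Pb bJ Pc cJ lc mb mc n2 j1 c1))

      contiguity : Contiguity n A (1+ j)
      contiguity = begin
        t (1+ n) A (1+ j)                                   ≈⟨ t₁≈ ⟩
        (Y * Z₁ * r-t₁) ÷ Dn                                ≈⟨ *-congʳ (*-congˡ numerators) ⟩
        (Y * Z₁ * (r-ρt₀ + (r-g₁ - r-g₀))) ÷ Dn             ≈⟨ split (Y * Z₁) r-ρt₀ r-g₁ r-g₀ (inv Dn) ⟩
        (Y * Z₁ * r-ρt₀) ÷ Dn + ((Y * Z₁ * r-g₁) ÷ Dn - (Y * Z₁ * r-g₀) ÷ Dn)
                                                            ≈⟨ +-cong ρt₀≈ (+-cong g₁≈ (-‿cong g₀≈)) ⟨
        ρ A * t n (A + 1#) (1+ j) + (g n A (1+ (1+ j)) - g n A (1+ j)) ∎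
        where
        numerators : r-t₁ ≈ r-ρt₀ + (r-g₁ - r-g₀)
        numerators = solve 6 (λ A b g J N C → let module P = LinearFactors A b g J N in
            :-_ (P.wT :* P.mb :* P.mc) :* ((κ 1 :+ N) :* C)
            := :-_ (P.abc :* P.aJ :* P.w0) :* ((N :- J) :* C)
               :+ (:-_ (P.aJ :* P.bJ1 :* P.c1) :* ((N :- J) :* C) :- P.mb :* P.mc :* P.n2 :* P.j1 :* C))
          refl A β γ J N Cj
        split : ∀ y a b c i → (y * (a + (b - c))) * i ≈ (y * a) * i + ((y * b) * i - (y * c) * i)
        split = solve 5 (λ y a b c i → (y :* (a :+ (b :- c))) :* i := (y :* a) :* i :+ ((y :* b) :* i :- (y :* c) :* i)) refl

      ρ′-den≉0 : lb * (lc * lc) ≉ 0#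
      ρ′-den≉0 = *-≉0 lb≉0 (*-≉0 lc≉0 lc≉0)
      ρt₀-den≉0 : lb * lc * t-den n (A + 1#) (1+ j) ≉ 0#
      ρt₀-den≉0 = *-≉0 ρ-den≉0 t₀-den≉0

      s₁ s₂ s₃ s₄ s₅ : Carrier
      s₁ = (β * w0 * mc * c1) * ((N - J) * Cj)
      s₂ = - (abc * w0 * lc * c1) * ((N - J) * Cj)
      s₃ = - (abc * w0 * mc * c1) * ((N - J) * Cj)
      s₄ = - (bJ1 * c1 * lc * mc) * ((N - J) * Cj)
      s₅ = - (bJ1 * c1 * lc * c1) * ((N - J) * Cj)

      ρ′t₀≈ : ρ′ A * t n (A + 1#) (1+ j) ≈ (Y * Z₂ * s₁) ÷ Dn
      ρ′t₀≈ = trans (÷-*-÷ _ _ ρ′-den≉0 t₀-den≉0) (÷-rescale (mc * j1 * c1) Dn≉0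
        (solve 11 (λ lb Qb lc Qc Qn n1 n2 mb mc j1 c1 →
            lb :* (lc :* lc) :* (Qb :* mb :* (Qc :* mc) :* (Qn :* n1 :* n2)) :* (mc :* j1 :* c1)
            := (Qb :* Qc :* Qn) :* (lb :* lc :* lc :* mb :* mc :* mc :* n1 :* n2 :* j1 :* c1))
          refl lb Qb lc Qc Qn n1 n2 mb mc j1 c1)
        (trans (solve 14 (λ sj Cj1 A b Pa aJ Pb bJ Pc cJ w0 mc j1 c1 →
                   :-_ (A :* b) :* (:-_ sj :* Cj1 :* (Pa :* aJ) :* (Pb :* bJ) :* (Pc :* cJ) :* w0) :* (mc :* j1 :* c1)
                   := (sj :* Pa :* Pb :* Pc) :* (A :* aJ :* bJ :* cJ) :* ((b :* w0 :* mc :* c1) :* (j1 :* Cj1)))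
                 refl sj Cj1 A β Pa aJ Pb bJ Pc cJ w0 mc j1 c1)
           (*-congˡ (*-congˡ (binom-suc (nat n) j)))))

      ρt₀/mc≈ : ρ A * t n (A + 1#) (1+ j) * inv mc ≈ (Y * Z₂ * s₂) ÷ Dn
      ρt₀/mc≈ = trans (*-congʳ (÷-*-÷ _ _ ρ-den≉0 t₀-den≉0))
        (trans (÷-*-inv _ ρt₀-den≉0 mc≉0) (÷-rescale (lc * j1 * c1) Dn≉0
        (solve 11 (λ lb Qb lc Qc Qn n1 n2 mb mc j1 c1 →
            lb :* lc :* (Qb :* mb :* (Qc :* mc) :* (Qn :* n1 :* n2)) :* mc :* (lc :* j1 :* c1)
            := (Qb :* Qc :* Qn) :* (lb :* lc :* lc :* mb :* mc :* mc :* n1 :* n2 :* j1 :* c1))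
          refl lb Qb lc Qc Qn n1 n2 mb mc j1 c1)
        (trans (solve 14 (λ sj Cj1 A abc Pa aJ Pb bJ Pc cJ w0 lc j1 c1 →
                   A :* abc :* (:-_ sj :* Cj1 :* (Pa :* aJ) :* (Pb :* bJ) :* (Pc :* cJ) :* w0) :* (lc :* j1 :* c1)
                   := (sj :* Pa :* Pb :* Pc) :* (A :* aJ :* bJ :* cJ) :* (:-_ (abc :* w0 :* lc :* c1) :* (j1 :* Cj1)))
                 refl sj Cj1 A abc Pa aJ Pb bJ Pc cJ w0 lc j1 c1)
           (*-congˡ (*-congˡ (binom-suc (nat n) j))))))

      ρt₀/lc≈ : ρ A * t n (A + 1#) (1+ j) * inv lc ≈ (Y * Z₂ * s₃) ÷ Dn
      ρt₀/lc≈ = trans (*-congʳ (÷-*-÷ _ _ ρ-den≉0 t₀-den≉0))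
        (trans (÷-*-inv _ ρt₀-den≉0 lc≉0) (÷-rescale (mc * j1 * c1) Dn≉0
        (solve 11 (λ lb Qb lc Qc Qn n1 n2 mb mc j1 c1 →
            lb :* lc :* (Qb :* mb :* (Qc :* mc) :* (Qn :* n1 :* n2)) :* lc :* (mc :* j1 :* c1)
            := (Qb :* Qc :* Qn) :* (lb :* lc :* lc :* mb :* mc :* mc :* n1 :* n2 :* j1 :* c1))
          refl lb Qb lc Qc Qn n1 n2 mb mc j1 c1)
        (trans (solve 14 (λ sj Cj1 A abc Pa aJ Pb bJ Pc cJ w0 mc j1 c1 →
                   A :* abc :* (:-_ sj :* Cj1 :* (Pa :* aJ) :* (Pb :* bJ) :* (Pc :* cJ) :* w0) :* (mc :* j1 :* c1)
                   := (sj :* Pa :* Pb :* Pc) :* (A :* aJ :* bJ :* cJ) :* (:-_ (abc :* w0 :* mc :* c1) :* (j1 :* Cj1)))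
                 refl sj Cj1 A abc Pa aJ Pb bJ Pc cJ w0 mc j1 c1)
           (*-congˡ (*-congˡ (binom-suc (nat n) j))))))

      g₁/c1≈ : g n A (1+ (1+ j)) * inv c1 ≈ (Y * Z₂ * s₄) ÷ Dn
      g₁/c1≈ = trans (÷-*-inv _ g₁-den≉0 c1≉0) (÷-rescale (lc * mc * j1) Dn≉0
        (trans (*-congʳ (*-congʳ g₁-den))
          (solve 11 (λ lb Qb lc Qc Qn n1 n2 mb mc j1 c1 →
              lb :* Qb :* mb :* (lc :* Qc :* mc) :* (Qn :* n1 :* n2) :* c1 :* (lc :* mc :* j1)
              := (Qb :* Qc :* Qn) :* (lb :* lc :* lc :* mb :* mc :* mc :* n1 :* n2 :* j1 :* c1))
            refl lb Qb lc Qc Qn n1 n2 mb mc j1 c1))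
        (trans (*-congʳ g₁-num)
          (trans (solve 14 (λ sj Cj1 A Pa aJ Pb bJ bJ1 Pc cJ lc mc j1 c1 →
                     :-_ sj :* Cj1 :* (A :* Pa :* aJ) :* (Pb :* bJ :* bJ1) :* (Pc :* cJ :* c1) :* (lc :* mc :* j1)
                     := (sj :* Pa :* Pb :* Pc) :* (A :* aJ :* bJ :* cJ) :* (:-_ (bJ1 :* c1 :* lc :* mc) :* (j1 :* Cj1)))
                   refl sj Cj1 A Pa aJ Pb bJ bJ1 Pc cJ lc mc j1 c1)
           (*-congˡ (*-congˡ (binom-suc (nat n) j))))))

      g₁/mc≈ : g n A (1+ (1+ j)) * inv mc ≈ (Y * Z₂ * s₅) ÷ Dn
      g₁/mc≈ = trans (÷-*-inv _ g₁-den≉0 mc≉0) (÷-rescale (lc * j1 * c1) Dn≉0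
        (trans (*-congʳ (*-congʳ g₁-den))
          (solve 11 (λ lb Qb lc Qc Qn n1 n2 mb mc j1 c1 →
              lb :* Qb :* mb :* (lc :* Qc :* mc) :* (Qn :* n1 :* n2) :* mc :* (lc :* j1 :* c1)
              := (Qb :* Qc :* Qn) :* (lb :* lc :* lc :* mb :* mc :* mc :* n1 :* n2 :* j1 :* c1))
            refl lb Qb lc Qc Qn n1 n2 mb mc j1 c1))
        (trans (*-congʳ g₁-num)
          (trans (solve 14 (λ sj Cj1 A Pa aJ Pb bJ bJ1 Pc cJ lc mc j1 c1 →
                     :-_ sj :* Cj1 :* (A :* Pa :* aJ) :* (Pb :* bJ :* bJ1) :* (Pc :* cJ :* c1) :* (lc :* j1 :* c1)
                     := (sj :* Pa :* Pb :* Pc) :* (A :* aJ :* bJ :* cJ) :* (:-_ (bJ1 :* c1 :* lc :* c1) :* (j1 :* Cj1)))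
                   refl sj Cj1 A Pa aJ Pb bJ bJ1 Pc cJ lc mc j1 c1)
           (*-congˡ (*-congˡ (binom-suc (nat n) j))))))

      contiguity′ : Contiguity′ n A (1+ j)
      contiguity′ = begin
        ρ′ A * T + ρ A * T * (inv (A + 1# - γ + nat (1+ j)) - inv lc) + G * (inv (γ + nat (1+ j)) + inv (A + 1# - γ + nat (1+ j)))
          ≈⟨ +-cong (+-congˡ (*-congˡ (+-congʳ (inv-cong mc≈)))) (*-congˡ (+-congˡ (inv-cong mc≈))) ⟩
        ρ′ A * T + ρ A * T * (inv mc - inv lc) + G * (inv c1 + inv mc)
          ≈⟨ expand (ρ′ A * T) (ρ A * T) G (inv mc) (inv lc) (inv c1) ⟩
        ρ′ A * T + ρ A * T * inv mc - ρ A * T * inv lc + G * inv c1 + G * inv mc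
          ≈⟨ +-cong (+-cong (+-cong (+-cong ρ′t₀≈ ρt₀/mc≈) (-‿cong ρt₀/lc≈)) g₁/c1≈) g₁/mc≈ ⟩
        (Y * Z₂ * s₁) ÷ Dn + (Y * Z₂ * s₂) ÷ Dn - (Y * Z₂ * s₃) ÷ Dn + (Y * Z₂ * s₄) ÷ Dn + (Y * Z₂ * s₅) ÷ Dn
          ≈⟨ collect (Y * Z₂) s₁ s₂ s₃ s₄ s₅ (inv Dn) ⟩
        (Y * Z₂ * (s₁ + s₂ - s₃ + s₄ + s₅)) ÷ Dn
          ≈⟨ *-congʳ (trans (*-congˡ numerators) (zeroʳ _)) ⟩
        0# * inv Dn
          ≈⟨ zeroˡ _ ⟩
        0# ∎
        where
        T G : Carrier
        T = t n (A + 1#) (1+ j)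
        G = g n A (1+ (1+ j))
        expand : ∀ x y z a b c → x + y * (a - b) + z * (c + a) ≈ x + y * a - y * b + z * c + z * a
        expand = solve 6 (λ x y z a b c → x :+ y :* (a :- b) :+ z :* (c :+ a) := x :+ y :* a :- y :* b :+ z :* c :+ z :* a) refl
        collect : ∀ y a b c d e i →
          (y * a) * i + (y * b) * i - (y * c) * i + (y * d) * i + (y * e) * i ≈ (y * (a + b - c + d + e)) * i
        collect = solve 7 (λ y a b c d e i →
                     (y :* a) :* i :+ (y :* b) :* i :- (y :* c) :* i :+ (y :* d) :* i :+ (y :* e) :* i
                     := (y :* (a :+ b :- c :+ d :+ e)) :* i)
                   refl
        numerators : s₁ + s₂ - s₃ + s₄ + s₅ ≈ 0#
        numerators = solve 6 (λ A b g J N C → let module P = LinearFactors A b g J N in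
            (b :* P.w0 :* P.mc :* P.c1) :* ((N :- J) :* C)
            :+ :-_ (P.abc :* P.w0 :* P.lc :* P.c1) :* ((N :- J) :* C)
            :- :-_ (P.abc :* P.w0 :* P.mc :* P.c1) :* ((N :- J) :* C)
            :+ :-_ (P.bJ1 :* P.c1 :* P.lc :* P.mc) :* ((N :- J) :* C)
            :+ :-_ (P.bJ1 :* P.c1 :* P.lc :* P.c1) :* ((N :- J) :* C)
            := κ 0)
          refl A β γ J N Cj

  module Lower (n : ℕ) (A : Carrier) where
    lb lc abc w : Carrier
    lb = A + 1# - β
    lc = A + 1# - γ
    abc = A + 1# - β - γ
    w = A + nat (1+ n)

    t₀-zero : t n (A + 1#) 0 ≈ (A + 1#) ÷ w
    t₀-zero = trans (t-zero n (A + 1#)) (*-congˡ (inv-cong (+-assoc A 1# (nat n))))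

    module _ (lb≉0 : lb ≉ 0#) (lc≉0 : lc ≉ 0#) (γ≉0 : γ ≉ 0#) (w≉0 : w ≉ 0#) where
      ρt₀≈ : ρ A * t n (A + 1#) 0 ≈ (A * abc * (A + 1#)) ÷ (lb * lc * w)
      ρt₀≈ = trans (*-congˡ t₀-zero) (÷-*-÷ _ _ (*-≉0 lb≉0 lc≉0) w≉0)

      contiguity : Contiguity n A 0
      contiguity = begin
        t (1+ n) A 0                                           ≈⟨ t-zero (1+ n) A ⟩
        A ÷ w                                                  ≈⟨ ÷-rescale (lb * lc) (*-≉0 (*-≉0 lb≉0 lc≉0) w≉0) (*-comm w _) refl ⟩
        (A * (lb * lc)) ÷ (lb * lc * w)                        ≈⟨ *-congʳ numerators ⟩
        (A * abc * (A + 1#) + A * β * γ) ÷ (lb * lc * w)       ≈⟨ distribʳ _ _ _ ⟩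
        (A * abc * (A + 1#)) ÷ (lb * lc * w) + (A * β * γ) ÷ (lb * lc * w)
                                                               ≈⟨ +-cong ρt₀≈ (trans (x-0≈x _) (g-one n A)) ⟨
        ρ A * t n (A + 1#) 0 + (g n A 1 - g n A 0)             ∎
        where
        numerators : A * (lb * lc) ≈ A * abc * (A + 1#) + A * β * γ
        numerators = solve 3 (λ A b c →
                        A :* ((A :+ κ 1 :- b) :* (A :+ κ 1 :- c))
                        := A :* (A :+ κ 1 :- b :- c) :* (A :+ κ 1) :+ A :* b :* c)
                      refl A β γ
        x-0≈x : ∀ x → x - 0# ≈ x
        x-0≈x = solve 1 (λ x → x :- κ 0 := x) refl

      contiguity′ : Contiguity′ n A 0
      contiguity′ = begin
        ρ′ A * T + ρ A * T * (inv (lc + 0#) - inv lc) + G * (inv (γ + 0#) + inv (lc + 0#))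
          ≈⟨ +-cong (+-congˡ (*-congˡ (+-congʳ (inv-cong (+-identityʳ lc))))) (*-congˡ (+-cong (inv-cong (+-identityʳ γ)) (inv-cong (+-identityʳ lc)))) ⟩
        ρ′ A * T + ρ A * T * (inv lc - inv lc) + G * (inv γ + inv lc)
          ≈⟨ expand (ρ′ A * T) (ρ A * T) G (inv lc) (inv γ) ⟩
        ρ′ A * T + G * inv γ + G * inv lc
          ≈⟨ +-cong (+-cong ρ′t₀≈ g₁/γ≈) g₁/lc≈ ⟩
        (- (A * β) * (A + 1#) * γ) ÷ D + (A * β * γ * lc) ÷ D + (A * β * γ * γ) ÷ D
          ≈⟨ numerators (inv D) ⟩
        0# ∎
        where
        T G D : Carrier
        T = t n (A + 1#) 0
        G = g n A 1
        D = lb * lc * lc * w * γ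
        D≉0 : D ≉ 0#
        D≉0 = *-≉0 (*-≉0 (*-≉0 (*-≉0 lb≉0 lc≉0) lc≉0) w≉0) γ≉0
        G-den≉0 : lb * lc * w ≉ 0#
        G-den≉0 = *-≉0 (*-≉0 lb≉0 lc≉0) w≉0
        ρ′t₀≈ : ρ′ A * T ≈ (- (A * β) * (A + 1#) * γ) ÷ D
        ρ′t₀≈ = trans (*-congˡ t₀-zero) (trans (÷-*-÷ _ _ (*-≉0 lb≉0 (*-≉0 lc≉0 lc≉0)) w≉0)
          (÷-rescale γ D≉0 (solve 4 (λ b c w g → b :* (c :* c) :* w :* g := b :* c :* c :* w :* g) refl lb lc w γ) refl))
        g₁/γ≈ : G * inv γ ≈ (A * β * γ * lc) ÷ D
        g₁/γ≈ = trans (*-congʳ (g-one n A)) (trans (÷-*-inv _ G-den≉0 γ≉0)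
          (÷-rescale lc D≉0 (solve 4 (λ b c w g → b :* c :* w :* g :* c := b :* c :* c :* w :* g) refl lb lc w γ) refl))
        g₁/lc≈ : G * inv lc ≈ (A * β * γ * γ) ÷ D
        g₁/lc≈ = trans (*-congʳ (g-one n A)) (trans (÷-*-inv _ G-den≉0 lc≉0)
          (÷-rescale γ D≉0 (solve 4 (λ b c w g → b :* c :* w :* c :* g := b :* c :* c :* w :* g) refl lb lc w γ) refl))
        expand : ∀ x y z a b → x + y * (a - a) + z * (b + a) ≈ x + z * b + z * a
        expand = solve 5 (λ x y z a b → x :+ y :* (a :- a) :+ z :* (b :+ a) := x :+ z :* b :+ z :* a) refl
        numerators : ∀ i → (- (A * β) * (A + 1#) * γ) * i + (A * β * γ * lc) * i + (A * β * γ * γ) * i ≈ 0#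
        numerators = solve 4 (λ A b c i →
                        :-_ (A :* b) :* (A :+ κ 1) :* c :* i :+ A :* b :* c :* (A :+ κ 1 :- c) :* i :+ A :* b :* c :* c :* i
                        := κ 0)
                      refl A β γ

  module Upper (n : ℕ) (A : Carrier) where
    open Interior n A n
      using (N; sj; Cj; C′; Pa; Pb; Pc; Qb; Qc; Qn; lb; lc; n1; n2; bJ; cJ; Q; Y;
             t₁-den; t₁-num; rising-lb; rising-lc; rising-n; n1≈)

    t₀-vanishes : t n (A + 1#) (1+ n) ≈ 0#
    t₀-vanishes = trans (*-congʳ (trans (*-congʳ (*-congʳ (*-congʳ (*-congʳ (*-congˡ (binom-nat-suc n))))))
      (solve 5 (λ s a b c d → s :* κ 0 :* a :* b :* c :* d := κ 0) refl _ _ _ _ _))) (zeroˡ _)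

    g-vanishes : g n A (1+ (1+ n)) ≈ 0#
    g-vanishes = trans (*-congʳ (trans (*-congʳ (*-congʳ (*-congʳ (*-congˡ (binom-nat-suc n)))))
      (solve 4 (λ s a b c → s :* κ 0 :* a :* b :* c := κ 0) refl _ _ _ _))) (zeroˡ _)

    contiguity′ : Contiguity′ n A (1+ n)
    contiguity′ = trans (+-cong (+-cong (*-congˡ t₀-vanishes) (*-congʳ (*-congˡ t₀-vanishes))) (*-congʳ g-vanishes))
      (solve 4 (λ a b u w → a :* κ 0 :+ b :* κ 0 :* u :+ κ 0 :* w := κ 0) refl _ _ _ _)

    module _ (Qb≉0 : Qb ≉ 0#) (Qc≉0 : Qc ≉ 0#) (Qn≉0 : Qn ≉ 0#) (lb≉0 : lb ≉ 0#) (lc≉0 : lc ≉ 0#)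
             (n1≉0 : n1 ≉ 0#) (n2≉0 : n2 ≉ 0#) where
      D′ : Carrier
      D′ = Q * (lb * lc * n1 * n2)
      D′≉0 : D′ ≉ 0#
      D′≉0 = *-≉0 (*-≉0 (*-≉0 Qb≉0 Qc≉0) Qn≉0) (*-≉0 (*-≉0 (*-≉0 lb≉0 lc≉0) n1≉0) n2≉0)

      t₁≈ : t (1+ n) A (1+ n) ≈ (Y * (- (A * bJ * cJ * n2) * Cj)) ÷ D′
      t₁≈ = ÷-rescale 1# D′≉0
        (trans (*-congʳ t₁-den) (solve 7 (λ lb Qb lc Qc Qn n1 n2 →
                                    (lb :* Qb) :* (lc :* Qc) :* (Qn :* n1 :* n2) :* κ 1
                                    := (Qb :* Qc :* Qn) :* (lb :* lc :* n1 :* n2))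
                                  refl lb Qb lc Qc Qn n1 n2))
        (trans (*-congʳ t₁-num) (trans
          (solve 9 (λ sj C A N Pa Pb bJ Pc cJ →
              :-_ sj :* C :* (A :* Pa) :* (Pb :* bJ) :* (Pc :* cJ) :* (A :+ κ 2 :* (κ 1 :+ N)) :* κ 1
              := (sj :* Pa :* Pb :* Pc) :* (:-_ (A :* bJ :* cJ :* (A :+ κ 1 :+ N :+ (κ 1 :+ N))) :* C))
            refl sj C′ A N Pa Pb bJ Pc cJ)
          (*-congˡ (*-congˡ (binom-nat-diagonal n)))))

      g₀≈ : g n A (1+ n) ≈ (Y * (A * bJ * cJ * n2 * Cj)) ÷ D′
      g₀≈ = ÷-rescale n2 D′≉0
        (trans (*-congʳ (*-cong (*-cong rising-lb rising-lc) (*-cong rising-n n1≈)))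
          (solve 7 (λ lb Qb lc Qc Qn n1 n2 →
              lb :* Qb :* (lc :* Qc) :* (Qn :* n1) :* n2
              := (Qb :* Qc :* Qn) :* (lb :* lc :* n1 :* n2))
            refl lb Qb lc Qc Qn n1 n2))
        (trans (*-congʳ (*-congʳ (*-congʳ (*-congˡ (rising-suc A n)))))
          (solve 9 (λ sj Cj A Pa Pb bJ Pc cJ n2 →
              sj :* Cj :* (A :* Pa) :* (Pb :* bJ) :* (Pc :* cJ) :* n2
              := (sj :* Pa :* Pb :* Pc) :* (A :* bJ :* cJ :* n2 :* Cj))
            refl sj Cj A Pa Pb bJ Pc cJ n2))

      contiguity : Contiguity n A (1+ n)
      contiguity = begin
        t (1+ n) A (1+ n)                                       ≈⟨ t₁≈ ⟩
        (Y * (- (A * bJ * cJ * n2) * Cj)) ÷ D′                  ≈⟨ rearrange (ρ A) Y (A * bJ * cJ * n2) Cj (inv D′) ⟩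
        ρ A * 0# + (0# - (Y * (A * bJ * cJ * n2 * Cj)) ÷ D′)    ≈⟨ +-cong (*-congˡ t₀-vanishes) (+-cong g-vanishes (-‿cong g₀≈)) ⟨
        ρ A * t n (A + 1#) (1+ n) + (g n A (1+ (1+ n)) - g n A (1+ n)) ∎
        where
        rearrange : ∀ r y a c i → (y * (- a * c)) * i ≈ r * 0# + (0# - (y * (a * c)) * i)
        rearrange = solve 5 (λ r y a c i → (y :* (:-_ a :* c)) :* i := r :* κ 0 :+ (κ 0 :- (y :* (a :* c)) :* i)) refl

  record Regular (n : ℕ) (A : Carrier) : Set ℓ where
    field
      den-β  : ∀ i → i < n → A + 1# - β + nat i ≉ 0#
      den-γ  : ∀ i → i < n → A + 1# - γ + nat i ≉ 0#
      den-n  : ∀ i → i ≤ n → A + nat n + nat i ≉ 0#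
      den-βγ : ∀ i → i < n → A + 1# - β - γ + nat i ≉ 0#
      num-γ  : ∀ i → i < n → γ + nat i ≉ 0#

  regular-suc : ∀ {n A} → Regular (1+ n) A → Regular n (A + 1#)
  regular-suc {n} {A} h = record
    { den-β  = λ i i<n → ≉0-resp (shift-index A β i) (den-β (1+ i) (s≤s i<n))
    ; den-γ  = λ i i<n → ≉0-resp (shift-index A γ i) (den-γ (1+ i) (s≤s i<n))
    ; den-n  = λ i i≤n → ≉0-resp (+-congʳ (+-assoc A 1# (nat n))) (den-n i (ℕ.m≤n⇒m≤1+n i≤n))
    ; den-βγ = λ i i<n → ≉0-resp (shift-index-βγ A i) (den-βγ (1+ i) (s≤s i<n))
    ; num-γ  = λ i i<n → num-γ i (ℕ.m<n⇒m<1+n i<n)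
    }
    where open Regular h

  module Step {n : ℕ} {A : Carrier} (h : Regular (1+ n) A) where
    open Regular h
    module h′ = Regular (regular-suc h)

    base≉0 : ∀ {z} → (∀ i → i < 1+ n → z + nat i ≉ 0#) → z ≉ 0#
    base≉0 z+i≉0 = ≉0-resp (sym (+-identityʳ _)) (z+i≉0 0 (s≤s z≤n))

    lb≉0 : A + 1# - β ≉ 0#
    lb≉0 = base≉0 den-β
    lc≉0 : A + 1# - γ ≉ 0#
    lc≉0 = base≉0 den-γ
    abc≉0 : A + 1# - β - γ ≉ 0#
    abc≉0 = base≉0 den-βγ
    w≉0 : A + nat (1+ n) ≉ 0#
    w≉0 = ≉0-resp (sym (+-identityʳ _)) (den-n 0 z≤n)

    Qb≉0 : ∀ {j} → j ≤ n → rising (A + 1# + 1# - β) j ≉ 0#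
    Qb≉0 j≤n = rising-≉0 _ _ (λ i i<j → h′.den-β i (ℕ.<-≤-trans i<j j≤n))
    Qc≉0 : ∀ {j} → j ≤ n → rising (A + 1# + 1# - γ) j ≉ 0#
    Qc≉0 j≤n = rising-≉0 _ _ (λ i i<j → h′.den-γ i (ℕ.<-≤-trans i<j j≤n))
    Qn≉0 : ∀ {j} → j ≤ n → rising (A + 1# + nat n) j ≉ 0#
    Qn≉0 j≤n = rising-≉0 _ _ (λ i i<j → h′.den-n i (ℕ.≤-trans (ℕ.<⇒≤ i<j) j≤n))

    contiguity-at : ∀ k → k ≤ 1+ n → Contiguity n A k
    contiguity-at zero     _ =
      Lower.contiguity n A lb≉0 lc≉0 (base≉0 num-γ) w≉0
    contiguity-at (1+ j) (s≤s j≤n) with j ℕ.≟ n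
    ... | yes ≡.refl = Upper.contiguity n A (Qb≉0 ℕ.≤-refl) (Qc≉0 ℕ.≤-refl) (Qn≉0 ℕ.≤-refl) lb≉0 lc≉0
                         (h′.den-n n ℕ.≤-refl)
                         (≉0-resp (+-congʳ (+-assoc A 1# (nat n))) (den-n (1+ n) ℕ.≤-refl))
    ... | no  j≢n   = Interior.contiguity n A j (Qb≉0 j≤n) (Qc≉0 j≤n) (Qn≉0 j≤n) lb≉0 lc≉0
                         (h′.den-β j j<n) (h′.den-γ j j<n) (h′.den-n j j≤n) (h′.den-n (1+ j) j<n) (num-γ (1+ j) (s≤s j<n))
      where j<n = ℕ.≤∧≢⇒< j≤n j≢n

    contiguity′-at : ∀ k → k ≤ 1+ n → Contiguity′ n A k
    contiguity′-at zero     _ =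
      Lower.contiguity′ n A lb≉0 lc≉0 (base≉0 num-γ) w≉0
    contiguity′-at (1+ j) (s≤s j≤n) with j ℕ.≟ n
    ... | yes ≡.refl = Upper.contiguity′ n A
    ... | no  j≢n   = Interior.contiguity′ n A j (Qb≉0 j≤n) (Qc≉0 j≤n) (Qn≉0 j≤n) lb≉0 lc≉0
                         (h′.den-β j j<n) (h′.den-γ j j<n) (h′.den-n j j≤n) (h′.den-n (1+ j) j<n) (num-γ (1+ j) (s≤s j<n))
      where j<n = ℕ.≤∧≢⇒< j≤n j≢n

    R-suc : R (1+ n) A ≈ ρ A * R n (A + 1#)
    R-suc = begin
      (rising A (1+ n) * rising (A + 1# - β - γ) (1+ n)) ÷ (rising (A + 1# - β) (1+ n) * rising (A + 1# - γ) (1+ n))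
        ≈⟨ *-cong (*-cong (rising-suc A n) (trans (rising-suc _ n) (*-congˡ (rising-cong n (solve 3 (λ A b c →
                                                                                               A :+ κ 1 :- b :- c :+ κ 1
                                                                                               := A :+ κ 1 :+ κ 1 :- b :- c)
                                                                                             refl A β γ)))))
                  (inv-cong (*-cong (trans (rising-suc _ n) (*-congˡ (rising-cong n (shift-base A β))))
                                    (trans (rising-suc _ n) (*-congˡ (rising-cong n (shift-base A γ)))))) ⟩
      (A * rising (A + 1#) n * ((A + 1# - β - γ) * rising (A + 1# + 1# - β - γ) n))
        ÷ ((A + 1# - β) * rising (A + 1# + 1# - β) n * ((A + 1# - γ) * rising (A + 1# + 1# - γ) n))
        ≈⟨ *-cong (*-interchange _ _ _ _) (inv-cong (*-interchange _ _ _ _)) ⟩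
      (A * (A + 1# - β - γ) * (rising (A + 1#) n * rising (A + 1# + 1# - β - γ) n))
        ÷ ((A + 1# - β) * (A + 1# - γ) * (rising (A + 1# + 1# - β) n * rising (A + 1# + 1# - γ) n))
        ≈⟨ ÷-*-÷ _ _ (*-≉0 lb≉0 lc≉0) (*-≉0 (Qb≉0 ℕ.≤-refl) (Qc≉0 ℕ.≤-refl)) ⟨
      ρ A * R n (A + 1#) ∎

    δR-suc : δR (1+ n) A ≈ (inv (A + 1# - γ) - inv (A + 1# - β - γ)) + δR n (A + 1#)
    δR-suc = trans (Σ<-suc n _) (+-cong
      (+-cong (inv-cong (+-identityʳ _)) (-‿cong (inv-cong (+-identityʳ _))))
      (Σ<-cong n (λ i _ → +-cong (inv-cong (sym (shift-index A γ i))) (-‿cong (inv-cong (sym (shift-index-βγ A i)))))))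

    ρ-δ : ρ A * (inv (A + 1# - γ) - inv (A + 1# - β - γ)) ≈ ρ′ A
    ρ-δ = begin
      ρ A * (ic - ia)
        ≈⟨ *-congʳ (*-congˡ (inv-distrib-* lb≉0 lc≉0)) ⟩
      A * abc * (il * ic) * (ic - ia)
        ≈⟨ solve 5 (λ A abc il ic ia → A :* abc :* (il :* ic) :* (ic :- ia) := A :* il :* ic :* (abc :* ic :- abc :* ia)) refl A abc il ic ia ⟩
      A * il * ic * (abc * ic - abc * ia)
        ≈⟨ *-congˡ (+-congˡ (-‿cong (inv-nonzero _ abc≉0))) ⟩
      A * il * ic * (abc * ic - 1#)
        ≈⟨ *-congˡ (+-congˡ (-‿cong (inv-nonzero _ lc≉0))) ⟨
      A * il * ic * (abc * ic - lc * ic)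
        ≈⟨ solve 5 (λ A b c il ic →
              A :* il :* ic :* ((A :+ κ 1 :- b :- c) :* ic :- (A :+ κ 1 :- c) :* ic)
              := :-_ (A :* b) :* (il :* (ic :* ic)))
            refl A β γ il ic ⟩
      - (A * β) * (il * (ic * ic))
        ≈⟨ *-congˡ (trans (inv-distrib-* lb≉0 (*-≉0 lc≉0 lc≉0)) (*-congˡ (inv-distrib-* lc≉0 lc≉0))) ⟨
      ρ′ A ∎
      where
      abc lc il ic ia : Carrier
      abc = A + 1# - β - γ
      lc = A + 1# - γ
      il = inv (A + 1# - β)
      ic = inv (A + 1# - γ)
      ia = inv (A + 1# - β - γ)

    RδR-suc : R (1+ n) A * δR (1+ n) A ≈ ρ′ A * R n (A + 1#) + ρ A * (R n (A + 1#) * δR n (A + 1#))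
    RδR-suc = begin
      R (1+ n) A * δR (1+ n) A
        ≈⟨ *-cong R-suc δR-suc ⟩
      ρ A * R n (A + 1#) * ((inv (A + 1# - γ) - inv (A + 1# - β - γ)) + δR n (A + 1#))
        ≈⟨ solve 4 (λ r R d L → r :* R :* (d :+ L) := r :* d :* R :+ r :* (R :* L)) refl (ρ A) (R n (A + 1#)) _ (δR n (A + 1#)) ⟩
      ρ A * (inv (A + 1# - γ) - inv (A + 1# - β - γ)) * R n (A + 1#) + ρ A * (R n (A + 1#) * δR n (A + 1#))
        ≈⟨ +-congʳ (*-congʳ ρ-δ) ⟩
      ρ′ A * R n (A + 1#) + ρ A * (R n (A + 1#) * δR n (A + 1#)) ∎

  δt-shift : ∀ A k → δt (A + 1#) k ≈ δt A k - inv (A + 1# - γ) + inv (A + 1# - γ + nat k)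
  δt-shift A zero = sym (trans (+-congˡ (inv-cong (+-identityʳ _))) (solve 1 (λ u → κ 0 :- u :+ u := κ 0) refl _))
  δt-shift A (1+ k) = begin
    δt (A + 1#) k + (inv (γ + nat k) + inv (A + 1# + 1# - γ + nat k))
      ≈⟨ +-cong (δt-shift A k) (+-congˡ (inv-cong (shift-index A γ k))) ⟩
    δt A k - u₀ + inv (A + 1# - γ + nat k) + (inv (γ + nat k) + inv (A + 1# - γ + nat (1+ k)))
      ≈⟨ solve 5 (λ l u₀ uₖ w u → l :- u₀ :+ uₖ :+ (w :+ u) := l :+ (w :+ uₖ) :- u₀ :+ u) refl (δt A k) u₀ _ _ _ ⟩
    δt A k + (inv (γ + nat k) + inv (A + 1# - γ + nat k)) - u₀ + inv (A + 1# - γ + nat (1+ k)) ∎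
    where
    u₀ : Carrier
    u₀ = inv (A + 1# - γ)

  -- Contiguity′ is the derivative of Contiguity in γ; together with δt-shift it
  -- makes Contiguity times δt A k telescope in the same way as Contiguity.
  contiguity-δ : ∀ n A k → Contiguity n A k → Contiguity′ n A k →
    t (1+ n) A k * δt A k ≈ ρ′ A * t n (A + 1#) k + ρ A * (t n (A + 1#) k * δt (A + 1#) k)
                             + (g n A (1+ k) * δt A (1+ k) - g n A k * δt A k)
  contiguity-δ n A k e e′ = begin
    t (1+ n) A k * δt A k
      ≈⟨ *-congʳ e ⟩
    (ρ A * T + (g n A (1+ k) - g n A k)) * δt A k
      ≈⟨ +-identityʳ _ ⟨
    (ρ A * T + (g n A (1+ k) - g n A k)) * δt A k + 0#
      ≈⟨ +-congˡ e′ ⟨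
    (ρ A * T + (g n A (1+ k) - g n A k)) * δt A k
      + (ρ′ A * T + ρ A * T * (uₖ - u₀) + g n A (1+ k) * (w + uₖ))
      ≈⟨ solve 9 (λ r r′ T G₁ G₀ l uₖ u₀ w →
            (r :* T :+ (G₁ :- G₀)) :* l :+ (r′ :* T :+ r :* T :* (uₖ :- u₀) :+ G₁ :* (w :+ uₖ))
            := r′ :* T :+ r :* (T :* (l :- u₀ :+ uₖ)) :+ (G₁ :* (l :+ (w :+ uₖ)) :- G₀ :* l))
          refl (ρ A) (ρ′ A) T (g n A (1+ k)) (g n A k) (δt A k) uₖ u₀ w ⟩
    ρ′ A * T + ρ A * (T * (δt A k - u₀ + uₖ)) + (g n A (1+ k) * δt A (1+ k) - g n A k * δt A k)
      ≈⟨ +-congʳ (+-congˡ (*-congˡ (*-congˡ (δt-shift A k)))) ⟨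
    ρ′ A * T + ρ A * (T * δt (A + 1#) k) + (g n A (1+ k) * δt A (1+ k) - g n A k * δt A k) ∎
    where
    T u₀ uₖ w : Carrier
    T = t n (A + 1#) k
    u₀ = inv (A + 1# - γ)
    uₖ = inv (A + 1# - γ + nat k)
    w = inv (γ + nat k)

  t-zero-regular : ∀ A → Regular 0 A → t 0 A 0 ≈ 1#
  t-zero-regular A h = trans (t-zero 0 A) (trans (*-congʳ (sym (+-identityʳ A)))
    (inv-nonzero _ (≉0-resp (sym (+-identityʳ _)) (Regular.den-n h 0 z≤n))))

  R-zero : ∀ A → R 0 A ≈ 1#
  R-zero A = inv-nonzero _ (≉0-resp (*-identityˡ 1#) 1#≉0)

  sum-t≈R : ∀ n A → Regular n A → sumTo n (t n A) ≈ R n A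
  sum-t≈R zero   A h = trans (t-zero-regular A h) (sym (R-zero A))
  sum-t≈R (1+ n) A h = begin
    sumTo (1+ n) (t (1+ n) A)
      ≈⟨ sumTo-cong (1+ n) contiguity-at ⟩
    sumTo (1+ n) (λ k → ρ A * t n (A + 1#) k + (g n A (1+ k) - g n A k))
      ≈⟨ sumTo-+ (1+ n) _ _ ⟩
    sumTo (1+ n) (λ k → ρ A * t n (A + 1#) k) + sumTo (1+ n) (λ k → g n A (1+ k) - g n A k)
      ≈⟨ +-cong (sumTo-*ˡ (1+ n) _ _) (sumTo-telescope (1+ n) (g n A)) ⟩
    ρ A * sumTo (1+ n) (t n (A + 1#)) + (g n A (1+ (1+ n)) - 0#)
      ≈⟨ +-cong (*-congˡ (trans (+-cong (sum-t≈R n (A + 1#) (regular-suc h)) (Upper.t₀-vanishes n A)) (+-identityʳ _)))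
                (+-congʳ (Upper.g-vanishes n A)) ⟩
    ρ A * R n (A + 1#) + (0# - 0#)
      ≈⟨ trans (+-congˡ (-‿inverseʳ 0#)) (+-identityʳ _) ⟩
    ρ A * R n (A + 1#)
      ≈⟨ R-suc ⟨
    R (1+ n) A ∎
    where open Step h

  sum-tδt≈RδR : ∀ n A → Regular n A → sumTo n (λ k → t n A k * δt A k) ≈ R n A * δR n A
  sum-tδt≈RδR zero   A h = trans (zeroʳ _) (sym (zeroʳ _))
  sum-tδt≈RδR (1+ n) A h = begin
    sumTo (1+ n) (λ k → t (1+ n) A k * δt A k)
      ≈⟨ sumTo-cong (1+ n) (λ k k≤ → contiguity-δ n A k (contiguity-at k k≤) (contiguity′-at k k≤)) ⟩
    sumTo (1+ n) (λ k → ρ′ A * T k + ρ A * (T k * δt (A + 1#) k) + (gδ (1+ k) - gδ k))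
      ≈⟨ trans (sumTo-+ (1+ n) _ _) (+-cong (sumTo-+ (1+ n) _ _) (sumTo-telescope (1+ n) gδ)) ⟩
    sumTo (1+ n) (λ k → ρ′ A * T k) + sumTo (1+ n) (λ k → ρ A * (T k * δt (A + 1#) k)) + (gδ (1+ (1+ n)) - gδ 0)
      ≈⟨ +-cong (+-cong (sumTo-*ˡ (1+ n) _ _) (sumTo-*ˡ (1+ n) _ _))
                (trans (+-cong (trans (*-congʳ (Upper.g-vanishes n A)) (zeroˡ _)) (-‿cong (zeroˡ _))) (-‿inverseʳ 0#)) ⟩
    ρ′ A * sumTo (1+ n) T + ρ A * sumTo (1+ n) (λ k → T k * δt (A + 1#) k) + 0#
      ≈⟨ +-identityʳ _ ⟩
    ρ′ A * sumTo (1+ n) T + ρ A * sumTo (1+ n) (λ k → T k * δt (A + 1#) k)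
      ≈⟨ +-cong (*-congˡ (trans (+-cong (sum-t≈R n (A + 1#) h′) (Upper.t₀-vanishes n A)) (+-identityʳ _)))
                (*-congˡ (trans (+-cong (sum-tδt≈RδR n (A + 1#) h′) (trans (*-congʳ (Upper.t₀-vanishes n A)) (zeroˡ _))) (+-identityʳ _))) ⟩
    ρ′ A * R n (A + 1#) + ρ A * (R n (A + 1#) * δR n (A + 1#))
      ≈⟨ RδR-suc ⟨
    R (1+ n) A * δR (1+ n) A ∎
    where
    open Step h
    h′ : Regular n (A + 1#)
    h′ = regular-suc h
    T gδ : ℕ → Carrier
    T = t n (A + 1#)
    gδ k = g n A k * δt A k

module Specialisation {c ℓ} (F : CharZeroField c ℓ) (x y : CharZeroField.Carrier F) where
  open Binomials F

  β γ A : Carrier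
  β = y + 1#
  γ = x * half + 1#
  A = x - half + 1#

  open WellPoisedSum F β γ

  2≉0 : nat 2 ≉ 0#
  2≉0 = nat-≉0 2

  2*half≈1 : nat 2 * half ≈ 1#
  2*half≈1 = inv-nonzero (nat 2) 2≉0

  -- The solver treats half as an atom; an identity l ≈ r holding modulo
  -- 2 * half = 1 is obtained from the ring identity r = l + c * (2 * half - 1).
  modulo-half : ∀ {l r} c → r ≈ l + c * (nat 2 * half - 1#) → l ≈ r
  modulo-half {l} {r} c r≈ = sym (begin
    r                                ≈⟨ r≈ ⟩
    l + c * (nat 2 * half - 1#)      ≈⟨ +-congˡ (*-congˡ (trans (+-congʳ 2*half≈1) (-‿inverseʳ 1#))) ⟩
    l + c * 0#                       ≈⟨ +-congˡ (zeroʳ c) ⟩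
    l + 0#                           ≈⟨ +-identityʳ l ⟩
    l                                ∎)

  half[x-1]+1≈ : (x - 1#) * half + 1# ≈ A + 1# - γ
  half[x-1]+1≈ = modulo-half (- x) (solve 2 (λ x h →
                                       x :- h :+ κ 1 :+ κ 1 :- (x :* h :+ κ 1)
                                       := (x :- κ 1) :* h :+ κ 1 :+ :-_ x :* (κ 2 :* h :- κ 1))
                                     refl x half)

  half[x-1]+suc≈ : ∀ i → (x - 1#) * half + nat (1+ i) ≈ A + 1# - γ + nat i
  half[x-1]+suc≈ i = modulo-half (- x) (solve 3 (λ x h i →
                                           x :- h :+ κ 1 :+ κ 1 :- (x :* h :+ κ 1) :+ i
                                           := (x :- κ 1) :* h :+ (κ 1 :+ i) :+ :-_ x :* (κ 2 :* h :- κ 1))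
                                         refl x half (nat i))

  half[x-3]-y+1≈ : (x - nat 3) * half - y + 1# ≈ A + 1# - β - γ
  half[x-3]-y+1≈ = modulo-half (1# - x) (solve 3 (λ x y h →
                                            x :- h :+ κ 1 :+ κ 1 :- (y :+ κ 1) :- (x :* h :+ κ 1)
                                            := (x :- κ 3) :* h :- y :+ κ 1 :+ (κ 1 :- x) :* (κ 2 :* h :- κ 1))
                                          refl x y half)

  half[x-3]-y+suc≈ : ∀ i → (x - nat 3) * half - y + nat (1+ i) ≈ A + 1# - β - γ + nat i
  half[x-3]-y+suc≈ i = modulo-half (1# - x) (solve 4 (λ x y h i →
                                                x :- h :+ κ 1 :+ κ 1 :- (y :+ κ 1) :- (x :* h :+ κ 1) :+ i
                                                := (x :- κ 3) :* h :- y :+ (κ 1 :+ i) :+ (κ 1 :- x) :* (κ 2 :* h :- κ 1))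
                                              refl x y half (nat i))

  x-y-half+1≈ : x - y - half + 1# ≈ A + 1# - β
  x-y-half+1≈ = solve 3 (λ x y h → x :- y :- h :+ κ 1 := x :- h :+ κ 1 :+ κ 1 :- (y :+ κ 1)) refl x y half

  x-half+n+1≈ : ∀ n → x - half + nat n + 1# ≈ A + nat n
  x-half+n+1≈ n = solve 3 (λ x h n → x :- h :+ n :+ κ 1 := x :- h :+ κ 1 :+ n) refl x half (nat n)

  2[γ+i]≈ : ∀ i → nat 2 * (γ + nat i) ≈ x + nat (2 ℕ.+ 2 ℕ.* i)
  2[γ+i]≈ i = trans (modulo-half (- x) (solve 3 (λ x h i →
                                           x :+ (κ 1 :+ (κ 1 :+ κ 2 :* i))
                                           := κ 2 :* (x :* h :+ κ 1 :+ i) :+ :-_ x :* (κ 2 :* h :- κ 1))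
                                         refl x half (nat i)))
                    (+-congˡ (+-congˡ (+-congˡ (sym (nat-homo-* 2 i)))))

  2[A+1-γ+i]≈ : ∀ i → nat 2 * (A + 1# - γ + nat i) ≈ x + nat (1+ (2 ℕ.* i))
  2[A+1-γ+i]≈ i = trans (modulo-half (x + 1#) (solve 3 (λ x h i →
                                                  x :+ (κ 1 :+ κ 2 :* i)
                                                  := κ 2 :* (x :- h :+ κ 1 :+ κ 1 :- (x :* h :+ κ 1) :+ i) :+ (x :+ κ 1) :* (κ 2 :* h :- κ 1))
                                                refl x half (nat i)))
                        (+-congˡ (+-congˡ (sym (nat-homo-* 2 i))))

  2[A+n+i]≈ : ∀ n i → nat 2 * (A + nat n + nat i) ≈ 1# + nat 2 * x + nat 2 * nat n + nat 2 * nat i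
  2[A+n+i]≈ n i = modulo-half 1# (solve 4 (λ x h n i →
                                     κ 1 :+ κ 2 :* x :+ κ 2 :* n :+ κ 2 :* i
                                     := κ 2 :* (x :- h :+ κ 1 :+ n :+ i) :+ κ 1 :* (κ 2 :* h :- κ 1))
                                   refl x half (nat n) (nat i))

  2[A+2k]≈ : ∀ k → nat 2 * (A + nat 2 * nat k) ≈ 1# + nat 2 * x + nat 4 * nat k
  2[A+2k]≈ k = modulo-half 1# (solve 3 (λ x h k →
                                  κ 1 :+ κ 2 :* x :+ κ 4 :* k
                                  := κ 2 :* (x :- h :+ κ 1 :+ κ 2 :* k) :+ κ 1 :* (κ 2 :* h :- κ 1))
                                refl x half (nat k))

  2*-≉0 : ∀ {a b} → nat 2 * a ≈ b → b ≉ 0# → a ≉ 0#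
  2*-≉0 2a≈b b≉0 a≈0 = b≉0 (trans (sym 2a≈b) (trans (*-congˡ a≈0) (zeroʳ _)))

  inv-2* : ∀ {a b} → nat 2 * a ≈ b → b ≉ 0# → inv b ≈ half * inv a
  inv-2* 2a≈b b≉0 = trans (inv-cong (sym 2a≈b)) (inv-distrib-* 2≉0 (2*-≉0 2a≈b b≉0))

  H-even : ∀ k → (∀ j → 1 ≤ j → j ≤ 2 ℕ.* k → x + nat j ≉ 0#) → H (2 ℕ.* k) x ≈ half * δt A k
  H-even zero   _      = sym (zeroʳ half)
  H-even (1+ k) x+j≉0 = begin
    H (2 ℕ.* 1+ k) x
      ≈⟨ reflexive (≡.cong (λ m → H m x) (ℕ.*-suc 2 k)) ⟩
    H (2 ℕ.* k) x + inv (x + nat (1+ (2 ℕ.* k))) + inv (x + nat (2 ℕ.+ 2 ℕ.* k))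
      ≈⟨ +-cong (+-cong (H-even k (λ j 1≤j j≤2k → x+j≉0 j 1≤j (ℕ.≤-trans j≤2k (ℕ.*-monoʳ-≤ 2 (ℕ.n≤1+n k)))))
                        (inv-2* (2[A+1-γ+i]≈ k) (x+j≉0 _ (s≤s z≤n) 1+2k≤2[1+k])))
                (inv-2* (2[γ+i]≈ k) (x+j≉0 _ (s≤s z≤n) 2+2k≤2[1+k])) ⟩
    half * δt A k + half * inv (A + 1# - γ + nat k) + half * inv (γ + nat k)
      ≈⟨ solve 4 (λ h l u w → h :* l :+ h :* u :+ h :* w := h :* (l :+ (w :+ u))) refl half (δt A k) _ _ ⟩
    half * δt A (1+ k) ∎
    where
    2+2k≤2[1+k] : 2 ℕ.+ 2 ℕ.* k ≤ 2 ℕ.* 1+ k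
    2+2k≤2[1+k] = ℕ.≤-reflexive (≡.sym (ℕ.*-suc 2 k))
    1+2k≤2[1+k] : 1+ (2 ℕ.* k) ≤ 2 ℕ.* 1+ k
    1+2k≤2[1+k] = ℕ.≤-trans (ℕ.n≤1+n _) 2+2k≤2[1+k]

  binom-as-rising : ∀ {z w} k → z + 1# ≈ w → binom (z + nat k) k ≈ rising w k ÷ nat (k ℕ.!)
  binom-as-rising {z} k z+1≈w = trans (binom-rising z k) (*-congʳ (rising-cong k z+1≈w))

  rising≉0 : ∀ {z w} k → z + 1# ≈ w → binom (z + nat k) k ≉ 0# → rising w k ≉ 0#
  rising≉0 k z+1≈w b≉0 = *-≉0⇒≉0ˡ (≉0-resp (sym (binom-as-rising k z+1≈w)) b≉0)

  ÷-cancel-common³ : ∀ a b c d e f {i} → d ≉ 0# → e ≉ 0# → f ≉ 0# → i ≉ 0# →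
    (a * i * (b * i) * (c * i)) ÷ (d * i * (e * i) * (f * i)) ≈ (a * b * c) ÷ (d * e * f)
  ÷-cancel-common³ a b c d e f {i} d≉0 e≉0 f≉0 i≉0 = trans
    (*-cong (regroup a b c) (inv-cong (regroup d e f)))
    (÷-cancelʳ (a * b * c) (*-≉0 (*-≉0 d≉0 e≉0) f≉0) (*-≉0 (*-≉0 i≉0 i≉0) i≉0))
    where
    regroup : ∀ a b c → a * i * (b * i) * (c * i) ≈ a * b * c * (i * i * i)
    regroup a b c = solve 4 (λ a b c i → a :* i :* (b :* i) :* (c :* i) := a :* b :* c :* (i :* i :* i)) refl a b c i

  summand : ℕ → ℕ → Carrier
  summand n k = sign k * binom (nat n) k
      * ((binom (x * half + nat k) k * binom (x - half + nat k) k * binom (y + nat k) k)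
         ÷ (binom ((x - 1#) * half + nat k) k * binom (x - half + nat n + nat k) k
            * binom (x - y - half + nat k) k))
      * ((1# + nat 2 * x + nat 4 * nat k) ÷ (1# + nat 2 * x + nat 2 * nat n + nat 2 * nat k))
      * H (2 ℕ.* k) x

  summand≈ : ∀ n k →
    binom ((x - 1#) * half + nat k) k ≉ 0# →
    binom (x - half + nat n + nat k) k ≉ 0# →
    binom (x - y - half + nat k) k ≉ 0# →
    1# + nat 2 * x + nat 2 * nat n + nat 2 * nat k ≉ 0# →
    (∀ j → 1 ≤ j → j ≤ 2 ℕ.* k → x + nat j ≉ 0#) →
    summand n k ≈ half * (t n A k * δt A k)
  summand≈ n k lc≉0 n≉0 lb≉0 w≉0 x+j≉0 = begin
    summand n k
      ≈⟨ *-cong (*-cong (*-congˡ binomials) linear) (H-even k x+j≉0) ⟩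
    s * ((Pγ * PA * Pβ) ÷ (Plc * Pn * Plb)) * ((A + nat 2 * nat k) ÷ (A + nat n + nat k)) * (half * δt A k)
      ≈⟨ *-congʳ (trans (*-assoc _ _ _) (*-congˡ (÷-*-÷ _ _ (*-≉0 (*-≉0 Plc≉0 Pn≉0) Plb≉0) a₂≉0))) ⟩
    s * ((Pγ * PA * Pβ * (A + nat 2 * nat k)) ÷ (Plc * Pn * Plb * (A + nat n + nat k))) * (half * δt A k)
      ≈⟨ solve 8 (λ s c a b w h d i →
            s :* (c :* a :* b :* w :* i) :* (h :* d)
            := h :* (s :* a :* b :* c :* w :* i :* d))
          refl s Pγ PA Pβ (A + nat 2 * nat k) half (δt A k) _ ⟩
    half * ((s * PA * Pβ * Pγ * (A + nat 2 * nat k)) ÷ (Plc * Pn * Plb * (A + nat n + nat k)) * δt A k)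
      ≈⟨ *-congˡ (*-congʳ (*-congˡ (inv-cong (solve 4 (λ c m b w → c :* m :* b :* w := b :* c :* (m :* w)) refl Plc Pn Plb _)))) ⟩
    half * (t n A k * δt A k) ∎
    where
    s Pγ PA Pβ Plc Pn Plb : Carrier
    s = sign k * binom (nat n) k
    Pγ = rising γ k
    PA = rising A k
    Pβ = rising β k
    Plc = rising (A + 1# - γ) k
    Pn = rising (A + nat n) k
    Plb = rising (A + 1# - β) k
    Plc≉0 : Plc ≉ 0#
    Plc≉0 = rising≉0 k half[x-1]+1≈ lc≉0
    Pn≉0 : Pn ≉ 0#
    Pn≉0 = rising≉0 k (x-half+n+1≈ n) n≉0
    Plb≉0 : Plb ≉ 0#
    Plb≉0 = rising≉0 k x-y-half+1≈ lb≉0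
    a₂≉0 : A + nat n + nat k ≉ 0#
    a₂≉0 = 2*-≉0 (2[A+n+i]≈ n k) w≉0
    binomials : (binom (x * half + nat k) k * binom (x - half + nat k) k * binom (y + nat k) k)
                ÷ (binom ((x - 1#) * half + nat k) k * binom (x - half + nat n + nat k) k * binom (x - y - half + nat k) k)
                ≈ (Pγ * PA * Pβ) ÷ (Plc * Pn * Plb)
    binomials = trans
      (*-cong (*-cong (*-cong (binom-as-rising k refl) (binom-as-rising k refl)) (binom-as-rising k refl))
              (inv-cong (*-cong (*-cong (binom-as-rising k half[x-1]+1≈) (binom-as-rising k (x-half+n+1≈ n)))
                                (binom-as-rising k x-y-half+1≈))))
      (÷-cancel-common³ _ _ _ _ _ _ Plc≉0 Pn≉0 Plb≉0 (inv-≉0 (k!≉0 k)))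
    linear : (1# + nat 2 * x + nat 4 * nat k) ÷ (1# + nat 2 * x + nat 2 * nat n + nat 2 * nat k)
             ≈ (A + nat 2 * nat k) ÷ (A + nat n + nat k)
    linear = trans (*-cong (sym (trans (*-comm _ _) (2[A+2k]≈ k))) (inv-cong (sym (trans (*-comm _ _) (2[A+n+i]≈ n k)))))
                   (÷-cancelʳ _ a₂≉0 2≉0)

  closed-form≈ : ∀ n → binom ((x - 1#) * half + nat n) n ≉ 0# → binom (x - y - half + nat n) n ≉ 0# →
    (binom (x - half + nat n) n * binom ((x - nat 3) * half - y + nat n) n)
      ÷ (binom ((x - 1#) * half + nat n) n * binom (x - y - half + nat n) n)
    ≈ R n A
  closed-form≈ n lc≉0 lb≉0 = begin
    (binom (x - half + nat n) n * binom ((x - nat 3) * half - y + nat n) n)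
      ÷ (binom ((x - 1#) * half + nat n) n * binom (x - y - half + nat n) n)
      ≈⟨ *-cong (*-cong (binom-as-rising n refl) (binom-as-rising n half[x-3]-y+1≈))
                (inv-cong (trans (*-cong (binom-as-rising n half[x-1]+1≈) (binom-as-rising n x-y-half+1≈))
                                 (*-comm _ _))) ⟩
    (rising A n * i * (rising (A + 1# - β - γ) n * i)) ÷ (rising (A + 1# - β) n * i * (rising (A + 1# - γ) n * i))
      ≈⟨ *-cong (*-interchange _ _ _ _) (inv-cong (*-interchange _ _ _ _)) ⟩
    (rising A n * rising (A + 1# - β - γ) n * (i * i)) ÷ (rising (A + 1# - β) n * rising (A + 1# - γ) n * (i * i))
      ≈⟨ ÷-cancelʳ _ (*-≉0 (rising≉0 n x-y-half+1≈ lb≉0) (rising≉0 n half[x-1]+1≈ lc≉0)) (*-≉0 i≉0 i≉0) ⟩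
    R n A ∎
    where
    i : Carrier
    i = inv (nat (n ℕ.!))
    i≉0 : i ≉ 0#
    i≉0 = inv-≉0 (k!≉0 n)

  H-difference≈ : ∀ n → H n ((x - 1#) * half) - H n ((x - nat 3) * half - y) ≈ δR n A
  H-difference≈ n = trans (+-cong (sum1≈Σ< n _) (-‿cong (sum1≈Σ< n _))) (trans (Σ<-- n _ _)
    (Σ<-cong n (λ i _ → +-cong (inv-cong (half[x-1]+suc≈ i)) (-‿cong (inv-cong (half[x-3]-y+suc≈ i))))))

  regular : ∀ n →
    (∀ k → k ≤ n → 1# + nat 2 * x + nat 2 * nat n + nat 2 * nat k ≉ 0#) →
    (∀ j → 1 ≤ j → j ≤ 2 ℕ.* n → x + nat j ≉ 0#) →
    binom ((x - 1#) * half + nat n) n ≉ 0# →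
    binom (x - y - half + nat n) n ≉ 0# →
    (∀ j → 1 ≤ j → j ≤ n → (x - nat 3) * half - y + nat j ≉ 0#) →
    Regular n A
  regular n w≉0 x+j≉0 lc≉0 lb≉0 abc≉0 = record
    { den-β  = prod-≉0⇒≉0 n _ (rising≉0 n x-y-half+1≈ lb≉0)
    ; den-γ  = prod-≉0⇒≉0 n _ (rising≉0 n half[x-1]+1≈ lc≉0)
    ; den-n  = λ i i≤n → 2*-≉0 (2[A+n+i]≈ n i) (w≉0 i i≤n)
    ; den-βγ = λ i i<n → ≉0-resp (sym (half[x-3]-y+suc≈ i)) (abc≉0 (1+ i) (s≤s z≤n) i<n)
    ; num-γ  = λ i i<n → 2*-≉0 (2[γ+i]≈ i) (x+j≉0 (2 ℕ.+ 2 ℕ.* i) (s≤s z≤n)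
                           (ℕ.≤-trans (ℕ.≤-reflexive (≡.sym (ℕ.*-suc 2 i))) (ℕ.*-monoʳ-≤ 2 i<n)))
    }

theorem6 : ∀ {c ℓ} (F : CharZeroField c ℓ) → let open Ops F in
    (n : ℕ) (x y : Carrier) →
    (∀ k → k ≤ n → ¬ (binom ((x - 1#) * half + nat k) k ≈ 0#)) →
    (∀ k → k ≤ n → ¬ (binom (x - half + nat n + nat k) k ≈ 0#)) →
    (∀ k → k ≤ n → ¬ (binom (x - y - half + nat k) k ≈ 0#)) →
    (∀ k → k ≤ n → ¬ (1# + nat 2 * x + nat 2 * nat n + nat 2 * nat k ≈ 0#)) →
    (∀ k → k ≤ n → ∀ j → 1 ≤ j → j ≤ 2 Data.Nat.* k → ¬ (x + nat j ≈ 0#)) →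
    ¬ (binom ((x - 1#) * half + nat n) n ≈ 0#) →
    ¬ (binom (x - y - half + nat n) n ≈ 0#) →
    (∀ j → 1 ≤ j → j ≤ n → ¬ ((x - 1#) * half + nat j ≈ 0#)) →
    (∀ j → 1 ≤ j → j ≤ n → ¬ ((x - nat 3) * half - y + nat j ≈ 0#)) →
    sumTo n (λ k →
        sign k * binom (nat n) k
      * ((binom (x * half + nat k) k * binom (x - half + nat k) k * binom (y + nat k) k)
         ÷ (binom ((x - 1#) * half + nat k) k * binom (x - half + nat n + nat k) k
            * binom (x - y - half + nat k) k))
      * ((1# + nat 2 * x + nat 4 * nat k) ÷ (1# + nat 2 * x + nat 2 * nat n + nat 2 * nat k))
      * H (2 Data.Nat.* k) x)
    ≈ half * ((binom (x - half + nat n) n * binom ((x - nat 3) * half - y + nat n) n)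
              ÷ (binom ((x - 1#) * half + nat n) n * binom (x - y - half + nat n) n))
           * (H n ((x - 1#) * half) - H n ((x - nat 3) * half - y))
-- The hypothesis on (x - 1) / 2 + j is implied by the one on binom ((x - 1) / 2 + n) n.
theorem6 F n x y lc≉0 n≉0 lb≉0 w≉0 x+j≉0 lcₙ≉0 lbₙ≉0 _ abc≉0 = begin
  sumTo n (summand n)
    ≈⟨ sumTo-cong n (λ k k≤n → summand≈ n k (lc≉0 k k≤n) (n≉0 k k≤n) (lb≉0 k k≤n) (w≉0 k k≤n) (x+j≉0 k k≤n)) ⟩
  sumTo n (λ k → half * (t n A k * δt A k))
    ≈⟨ sumTo-*ˡ n half _ ⟩
  half * sumTo n (λ k → t n A k * δt A k)
    ≈⟨ *-congˡ (sum-tδt≈RδR n A (regular n w≉0 (x+j≉0 n ℕ.≤-refl) lcₙ≉0 lbₙ≉0 abc≉0)) ⟩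
  half * (R n A * δR n A)
    ≈⟨ trans (*-cong (*-congˡ (closed-form≈ n lcₙ≉0 lbₙ≉0)) (H-difference≈ n)) (*-assoc _ _ _) ⟨
  half * ((binom (x - half + nat n) n * binom ((x - nat 3) * half - y + nat n) n)
            ÷ (binom ((x - 1#) * half + nat n) n * binom (x - y - half + nat n) n))
         * (H n ((x - 1#) * half) - H n ((x - nat 3) * half - y)) ∎
  where
  open Binomials F
  open Specialisation F x y
  open WellPoisedSum F β γ using (t; δt; R; δR; sum-tδt≈RδR)
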